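{- Let $n\ge 1$ and let $\lambda=(\lambda_1\ge\lambda_2\ge\cdots\ge\lambda_\ell>0)$ be a partition of $n$. Let $x$ be a formal parameter. Then $$\frac{g_\lambda(x+1)-g_\lambda(x)}{H_\lambda}=\sum_{\mu\in\lambda\setminus 1}\frac{g_\mu(x)}{H_\mu},$$ where $g$, $H$ and $\lambda\setminus 1$ are as defined in the context.
   Context: For a partition $\lambda$ of $m$ (i.e. $|\lambda|=\lambda_1+\cdots+\lambda_\ell=m$), set $\lambda_i=0$ for $i>\ell(\lambda)$ and define the polynomial $g_\lambda(x)=\prod_{i=1}^{m}(x+\lambda_i-i)$ (the number of factors equals $m=|\lambda|$). For a box $(i,j)$ of the Ferrers diagram of $\lambda$ (row $i$, column $j$, $1\le j\le\lambda_i$), its hook length is $h_{(i,j)}(\lambda)=(\lambda_i-j)+(\lambda'_j-i)+1$, where $\lambda'_j=\#\{k:\lambda_k\ge j\}$; $H_\lambda$ denotes the product of the hook lengths of all boxes of $\lambda$. $\lambda\setminus 1$ denotes the set of all partitions $\mu$ of $n-1$ obtained from $\lambda$ by removing one corner box (i.e. removing the last box of a row $i$ with $\lambda_i>\lambda_{i+1}$). -}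

module Defs where

open import Data.Nat as ℕ using (ℕ; zero; suc; _∸_; _≤_; _<_; _≤?_; _<?_)
open import Data.Integer as ℤ using (+_)
open import Data.List using (List; []; _∷_; map; foldr; length; filter; concatMap; upTo)
open import Data.List.Relation.Unary.All using (All)
open import Data.List.Relation.Unary.Linked using (Linked)
open import Data.Product using (_×_)
open import Data.Rational as ℚ using (ℚ; 0ℚ; 1ℚ; _/_)

IsPartition : List ℕ → Set
IsPartition la = Linked (λ a b → b ≤ a) la × All (λ k → 0 < k) la

size : List ℕ → ℕ
size = foldr ℕ._+_ 0

-- λ_i, 1-indexed, with λ_i = 0 for i > ℓ(λ) (and for i = 0, unused)
part : List ℕ → ℕ → ℕ
part []       _             = 0
part (a ∷ as) zero          = 0
part (a ∷ as) (suc zero)    = a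
part (a ∷ as) (suc (suc i)) = part as (suc i)

range1 : ℕ → List ℕ
range1 m = map suc (upTo m)

fromℕ : ℕ → ℚ
fromℕ k = + k / 1

prodℚ : List ℚ → ℚ
prodℚ = foldr ℚ._*_ 1ℚ

sumℚ : List ℚ → ℚ
sumℚ = foldr ℚ._+_ 0ℚ

g : List ℕ → ℚ → ℚ
g la x = prodℚ (map (λ i → (x ℚ.+ fromℕ (part la i)) ℚ.- fromℕ i) (range1 (size la)))

conj : List ℕ → ℕ → ℕ
conj la j = length (filter (λ k → j ≤? k) la)

-- hook length of box (i,j): (λ_i − j) + (λ'_j − i) + 1  (both differences are ≥ 0 for boxes)
hook : List ℕ → ℕ → ℕ → ℕ
hook la i j = suc ((part la i ∸ j) ℕ.+ (conj la j ∸ i))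

H : List ℕ → ℕ
H la = foldr ℕ._*_ 1
  (concatMap (λ i → map (λ j → hook la i j) (range1 (part la i))) (range1 (length la)))

-- 1/k as a rational (k = 0 is sent to 0; never used since H_λ ≥ 1)
invℕ : ℕ → ℚ
invℕ zero    = 0ℚ
invℕ (suc k) = + 1 / suc k

decRow : List ℕ → ℕ → List ℕ
decRow []       _             = []
decRow (a ∷ as) zero          = a ∷ as
decRow (a ∷ as) (suc zero)    = (a ∸ 1) ∷ as
decRow (a ∷ as) (suc (suc i)) = a ∷ decRow as (suc i)

removeBox : List ℕ → ℕ → List ℕ
removeBox la i = filter (λ k → 0 <? k) (decRow la i)

-- λ∖1: all partitions obtained by removing a corner box (row i with λ_i > λ_{i+1});
-- distinct corners give distinct partitions, so this list enumerates the set without repetition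
corners : List ℕ → List ℕ
corners la = filter (λ i → part la (suc i) <? part la i) (range1 (length la))

removeCorner : List ℕ → List (List ℕ)
removeCorner la = map (removeBox la) (corners la)

-- Write aᵢ = λᵢ − i for 1 ≤ i ≤ n. Then g_λ(x) = ∏ᵢ (x + aᵢ), the aᵢ are distinct, and removing the
-- corner of row k lowers a_k by one. So the theorem is the polynomial identity
--   ∏ᵢ (x + 1 + aᵢ) − ∏ᵢ (x + aᵢ) = Σₖ cₖ ∏_{i<n} (x + aᵢ − δₖᵢ),  cₖ = H_λ / H_{λ∖k} at corners, 0 elsewhere,
-- between polynomials of degree n − 1. The key input is the hook-ratio identity
--   H_λ ∏_{i≠k} (aᵢ − a_k) = H_{λ∖k} (n + a_k) ∏_{i≠k} (1 + aᵢ − a_k)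
-- for a corner k, proved by peeling off the first row and the first column of λ. By Lagrange interpolation
-- at the nodes −aₖ it gives Σₖ cₖ = n, which matches the leading coefficients, and it makes both sides
-- agree at x = −aₖ for k < n; at a non-corner both sides vanish there since a_{k+1} = a_k − 1.

module Submission where

open import Defs
open import Data.Empty using (⊥; ⊥-elim)
open import Data.Integer as ℤ using () renaming (+_ to pos)
import Data.Integer.Properties as ZP
open import Data.List using (List; []; _∷_; map; length; filter; concatMap; concat; applyUpTo)
import Data.List.Properties as LP
open import Data.List.Relation.Unary.All as All using (All; []; _∷_)
import Data.List.Relation.Unary.All.Properties as AllP
open import Data.List.Relation.Unary.Linked using (Linked; []; [-]; _∷_)
open import Data.Nat as ℕ using (ℕ; zero; suc; _≤_; _<_; z≤n; s≤s; _∸_; _≤?_; _<?_)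
import Data.Nat.Properties as NP
open import Data.Nat.ListAction using (product)
open import Data.Nat.ListAction.Properties using (product-++)
import Data.Nat.Coprimality as C
open import Data.Product using (_,_)
open import Data.Rational as Q using (ℚ; 0ℚ; 1ℚ; mkℚ; _+_; _*_; -_; _-_)
import Data.Rational.Properties as QP
open import Data.Rational.Solver
open +-*-Solver
import Data.Rational.Unnormalised as U
import Data.Rational.Unnormalised.Properties as UP
open import Data.Sum using (_⊎_; inj₁; inj₂)
open import Function using (_∘_; id; case_of_)
open import Relation.Binary.Definitions using (tri<; tri≈; tri>)
open import Relation.Binary.PropositionalEquality
open import Relation.Nullary

ι : ℕ → ℚ
ι = fromℕ

ι≡mkℚ : ∀ k → ι k ≡ mkℚ (pos k) 0 (C.sym (C.1-coprimeTo k))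
ι≡mkℚ k = QP.normalize-coprime (C.sym (C.1-coprimeTo k))

ι-suc : ∀ k → ι (suc k) ≡ ι k + 1ℚ
ι-suc k = QP.toℚᵘ-injective
  (UP.≃-trans (QP.toℚᵘ-cong (ι≡mkℚ (suc k)))
  (UP.≃-trans step
  (UP.≃-trans (UP.≃-sym (UP.+-cong (QP.toℚᵘ-cong (ι≡mkℚ k)) (UP.≃-refl {U.mkℚᵘ (pos 1) 0})))
   (UP.≃-sym (QP.toℚᵘ-homo-+ (ι k) 1ℚ)))))
  where
  step : U.mkℚᵘ (pos (suc k)) 0 U.≃ (U.mkℚᵘ (pos k) 0 U.+ U.mkℚᵘ (pos 1) 0)
  step = U.*≡* (trans (ZP.*-identityʳ (pos (suc k))) (sym (trans (ZP.*-identityʳ _)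
           (trans (cong₂ ℤ._+_ (ZP.*-identityʳ (pos k)) (ZP.*-identityʳ (pos 1))) (cong pos (NP.+-comm k 1))))))

ι-+ : ∀ m n → ι (m ℕ.+ n) ≡ ι m + ι n
ι-+ zero n = sym (QP.+-identityˡ (ι n))
ι-+ (suc m) n = trans (ι-suc (m ℕ.+ n)) (trans (cong (_+ 1ℚ) (ι-+ m n))
  (trans (solve 3 (λ a b c → (a :+ b) :+ c := (a :+ c) :+ b) refl (ι m) (ι n) 1ℚ)
    (cong (_+ ι n) (sym (ι-suc m)))))

ι-* : ∀ m n → ι (m ℕ.* n) ≡ ι m * ι n
ι-* zero n = sym (QP.*-zeroˡ (ι n))
ι-* (suc m) n = trans (ι-+ n (m ℕ.* n)) (trans (cong (ι n +_) (ι-* m n))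
  (trans (solve 2 (λ a b → b :+ a :* b := (a :+ con 1ℚ) :* b) refl (ι m) (ι n))
    (cong (_* ι n) (sym (ι-suc m)))))

ι-injective : ∀ {m n} → ι m ≡ ι n → m ≡ n
ι-injective {m} {n} e = ZP.+-injective (cong Q.↥_ (trans (sym (ι≡mkℚ m)) (trans e (ι≡mkℚ n))))

ι-suc≢0 : ∀ k → ι (suc k) ≢ 0ℚ
ι-suc≢0 k e = case ι-injective {suc k} {0} e of λ ()

ι-suc-+ : ∀ a b → ι (suc (a ℕ.+ b)) ≡ ι a + ι b + 1ℚ
ι-suc-+ a b = trans (ι-suc (a ℕ.+ b)) (cong (_+ 1ℚ) (ι-+ a b))

ι-∸ : ∀ m n → n ℕ.≤ m → ι (m ℕ.∸ n) ≡ ι m - ι n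
ι-∸ m n n≤m = begin
  ι (m ℕ.∸ n) ≡⟨ solve 2 (λ a b → a := a :+ b :- b) refl (ι (m ℕ.∸ n)) (ι n) ⟩
  ι (m ℕ.∸ n) + ι n - ι n ≡⟨ cong (_- ι n) (sym (ι-+ (m ℕ.∸ n) n)) ⟩
  ι (m ℕ.∸ n ℕ.+ n) - ι n ≡⟨ cong (λ z → ι z - ι n) (NP.m∸n+n≡m n≤m) ⟩
  ι m - ι n ∎
  where open ≡-Reasoning

ι*invℕ : ∀ k → ι (suc k) * invℕ (suc k) ≡ 1ℚ
ι*invℕ k = trans (cong₂ _*_ (ι≡mkℚ (suc k)) (trans (QP.normalize-coprime (C.1-coprimeTo (suc k))) (QP.mkℚ-cong {n₂ = pos 1} {d₂ = k} {c₂ = C.1-coprimeTo (suc k)} refl refl)))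
   (QP.*-inverseʳ (mkℚ (pos (suc k)) 0 (C.sym (C.1-coprimeTo (suc k)))))

*-cancelˡ-≡ : ∀ a {b c} → a ≢ 0ℚ → a * b ≡ a * c → b ≡ c
*-cancelˡ-≡ a {b} {c} a≢0 e = begin
  b ≡⟨ solve 1 (λ b → b := con 1ℚ :* b) refl b ⟩
  1ℚ * b ≡⟨ cong (_* b) (sym (QP.*-inverseˡ a)) ⟩
  (Q.1/ a) * a * b ≡⟨ QP.*-assoc (Q.1/ a) a b ⟩
  (Q.1/ a) * (a * b) ≡⟨ cong ((Q.1/ a) *_) e ⟩
  (Q.1/ a) * (a * c) ≡⟨ sym (QP.*-assoc (Q.1/ a) a c) ⟩
  (Q.1/ a) * a * c ≡⟨ cong (_* c) (QP.*-inverseˡ a) ⟩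
  1ℚ * c ≡⟨ QP.*-identityˡ c ⟩
  c ∎
  where
  open ≡-Reasoning
  instance
    a-nonZero : Q.NonZero a
    a-nonZero = Q.≢-nonZero a≢0

-1ℚ : ℚ
-1ℚ = - 1ℚ

Π : ℕ → (ℕ → ℚ) → ℚ
Π zero f = 1ℚ
Π (suc N) f = f 1 * Π N (λ i → f (suc i))

Σ : ℕ → (ℕ → ℚ) → ℚ
Σ zero f = 0ℚ
Σ (suc N) f = f 1 + Σ N (λ i → f (suc i))

-- The product over 1 … N with the factor k left out; k = 0 leaves nothing out.
Π∖ : ℕ → ℕ → (ℕ → ℚ) → ℚ
Π∖ zero k f = 1ℚ
Π∖ (suc N) zero f = f 1 * Π∖ N zero (λ i → f (suc i))
Π∖ (suc N) (suc zero) f = Π N (λ i → f (suc i))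
Π∖ (suc N) (suc (suc k)) f = f 1 * Π∖ N (suc k) (λ i → f (suc i))

prodℚ-applyUpTo : ∀ N (h : ℕ → ℕ) (f : ℕ → ℚ) → prodℚ (map f (applyUpTo (λ i → h (suc i)) N)) ≡ Π N (λ i → f (h i))
prodℚ-applyUpTo zero h f = refl
prodℚ-applyUpTo (suc N) h f = cong (f (h 1) *_) (prodℚ-applyUpTo N (λ i → h (suc i)) f)

prodℚ-range1 : ∀ N (f : ℕ → ℚ) → prodℚ (map f (range1 N)) ≡ Π N f
prodℚ-range1 N f = trans (cong (λ l → prodℚ (map f l)) (LP.map-upTo suc N)) (prodℚ-applyUpTo N id f)

sumℚ-applyUpTo : ∀ N (h : ℕ → ℕ) (f : ℕ → ℚ) → sumℚ (map f (applyUpTo (λ i → h (suc i)) N)) ≡ Σ N (λ i → f (h i))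
sumℚ-applyUpTo zero h f = refl
sumℚ-applyUpTo (suc N) h f = cong (f (h 1) +_) (sumℚ-applyUpTo N (λ i → h (suc i)) f)

sumℚ-range1 : ∀ N (f : ℕ → ℚ) → sumℚ (map f (range1 N)) ≡ Σ N f
sumℚ-range1 N f = trans (cong (λ l → sumℚ (map f l)) (LP.map-upTo suc N)) (sumℚ-applyUpTo N id f)

ι-product : ∀ l → ι (product l) ≡ prodℚ (map ι l)
ι-product [] = refl
ι-product (x ∷ l) = trans (ι-* x (product l)) (cong (ι x *_) (ι-product l))

ι-product-range1 : ∀ a (h : ℕ → ℕ) → ι (product (map h (range1 a))) ≡ Π a (λ j → ι (h j))
ι-product-range1 a h = trans (ι-product (map h (range1 a)))
  (trans (cong prodℚ (sym (LP.map-∘ (range1 a)))) (prodℚ-range1 a (λ j → ι (h j))))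

applyUpTo-cong : ∀ {A : Set} n (f g : ℕ → A) → (∀ i → f i ≡ g i) → applyUpTo f n ≡ applyUpTo g n
applyUpTo-cong zero f g h = refl
applyUpTo-cong (suc n) f g h = cong₂ _∷_ (h 0) (applyUpTo-cong n (f ∘ suc) (g ∘ suc) (h ∘ suc))

sumℚ-filter : ∀ {P : ℕ → Set} (P? : (k : ℕ) → Dec (P k)) (h s : ℕ → ℚ) xs →
  (∀ k → P k → s k ≡ h k) → (∀ k → ¬ P k → s k ≡ 0ℚ) → sumℚ (map h (filter P? xs)) ≡ sumℚ (map s xs)
sumℚ-filter P? h s [] _ _ = refl
sumℚ-filter P? h s (x ∷ xs) hy hn with P? x
... | yes px = cong₂ _+_ (sym (hy x px)) (sumℚ-filter P? h s xs hy hn)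
... | no npx = trans (sumℚ-filter P? h s xs hy hn) (sym (trans (cong (_+ sumℚ (map s xs)) (hn x npx)) (QP.+-identityˡ (sumℚ (map s xs)))))

Π-cong : ∀ N {f g : ℕ → ℚ} → (∀ i → 1 ≤ i → i ≤ N → f i ≡ g i) → Π N f ≡ Π N g
Π-cong zero h = refl
Π-cong (suc N) h = cong₂ _*_ (h 1 (s≤s z≤n) (s≤s z≤n))
  (Π-cong N (λ i 1≤i i≤N → h (suc i) (s≤s z≤n) (s≤s i≤N)))

Σ-cong : ∀ N {f g : ℕ → ℚ} → (∀ i → 1 ≤ i → i ≤ N → f i ≡ g i) → Σ N f ≡ Σ N g
Σ-cong zero h = refl
Σ-cong (suc N) h = cong₂ _+_ (h 1 (s≤s z≤n) (s≤s z≤n))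
  (Σ-cong N (λ i 1≤i i≤N → h (suc i) (s≤s z≤n) (s≤s i≤N)))

Π∖-cong : ∀ N k {f g : ℕ → ℚ} → (∀ i → 1 ≤ i → i ≤ N → f i ≡ g i) → Π∖ N k f ≡ Π∖ N k g
Π∖-cong zero k h = refl
Π∖-cong (suc N) zero h = cong₂ _*_ (h 1 (s≤s z≤n) (s≤s z≤n))
  (Π∖-cong N zero (λ i 1≤i i≤N → h (suc i) (s≤s z≤n) (s≤s i≤N)))
Π∖-cong (suc N) (suc zero) h = Π-cong N (λ i 1≤i i≤N → h (suc i) (s≤s z≤n) (s≤s i≤N))
Π∖-cong (suc N) (suc (suc k)) h = cong₂ _*_ (h 1 (s≤s z≤n) (s≤s z≤n))
  (Π∖-cong N (suc k) (λ i 1≤i i≤N → h (suc i) (s≤s z≤n) (s≤s i≤N)))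

Π∖0≡Π : ∀ N f → Π∖ N zero f ≡ Π N f
Π∖0≡Π zero f = refl
Π∖0≡Π (suc N) f = cong (f 1 *_) (Π∖0≡Π N _)

Π≡f*Π∖ : ∀ N k f → 1 ≤ k → k ≤ N → Π N f ≡ f k * Π∖ N k f
Π≡f*Π∖ (suc N) (suc zero) f _ _ = refl
Π≡f*Π∖ (suc N) (suc (suc k)) f _ (s≤s k≤N) =
  trans (cong (f 1 *_) (Π≡f*Π∖ N (suc k) (λ i → f (suc i)) (s≤s z≤n) k≤N))
  (solve 3 (λ a b c → a :* (b :* c) := b :* (a :* c)) refl (f 1) (f (suc (suc k))) (Π∖ N (suc k) (λ i → f (suc i))))

Π-split : ∀ d t f → Π (d ℕ.+ t) f ≡ Π d f * Π t (λ i → f (d ℕ.+ i))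
Π-split zero t f = sym (QP.*-identityˡ _)
Π-split (suc d) t f = trans (cong (f 1 *_) (Π-split d t (λ i → f (suc i))))
  (sym (QP.*-assoc (f 1) (Π d (λ i → f (suc i))) (Π t (λ i → f (suc (d ℕ.+ i))))))

Π-last : ∀ N f → Π (suc N) f ≡ Π N f * f (suc N)
Π-last zero f = trans (QP.*-identityʳ (f 1)) (sym (QP.*-identityˡ (f 1)))
Π-last (suc N) f = trans (cong (f 1 *_) (Π-last N (λ i → f (suc i)))) (sym (QP.*-assoc (f 1) (Π N (λ i → f (suc i))) (f (suc (suc N)))))

Σ-+ : ∀ N (f g : ℕ → ℚ) → Σ N (λ i → f i + g i) ≡ Σ N f + Σ N g
Σ-+ zero f g = refl
Σ-+ (suc N) f g = trans (cong (f 1 + g 1 +_) (Σ-+ N _ _))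
  (solve 4 (λ a b c d → a :+ b :+ (c :+ d) := a :+ c :+ (b :+ d)) refl (f 1) (g 1) _ _)

Σ-scale : ∀ N c (f : ℕ → ℚ) → Σ N (λ i → c * f i) ≡ c * Σ N f
Σ-scale zero c f = sym (QP.*-zeroʳ c)
Σ-scale (suc N) c f = trans (cong (c * f 1 +_) (Σ-scale N c _)) (sym (QP.*-distribˡ-+ c _ _))

Σ-0 : ∀ N → Σ N (λ _ → 0ℚ) ≡ 0ℚ
Σ-0 zero = refl
Σ-0 (suc N) = trans (QP.+-identityˡ _) (Σ-0 N)

Σ-1 : ∀ N → Σ N (λ _ → 1ℚ) ≡ ι N
Σ-1 zero = refl
Σ-1 (suc N) = trans (cong (1ℚ +_) (Σ-1 N)) (trans (QP.+-comm 1ℚ (ι N)) (sym (ι-suc N)))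

Σ-single : ∀ N k f → 1 ≤ k → k ≤ N → (∀ i → i ≢ k → f i ≡ 0ℚ) → Σ N f ≡ f k
Σ-single (suc N) (suc zero) f _ _ h =
  trans (cong (f 1 +_) (trans (Σ-cong N (λ i 1≤i _ → h (suc i) (λ e → NP.<⇒≢ 1≤i (sym (NP.suc-injective e))))) (Σ-0 N))) (QP.+-identityʳ _)
Σ-single (suc N) (suc (suc k)) f _ (s≤s k≤N) h =
  trans (cong₂ _+_ (h 1 (λ ())) (Σ-single N (suc k) (λ i → f (suc i)) (s≤s z≤n) k≤N
     (λ i i≢ → h (suc i) (λ e → i≢ (NP.suc-injective e))))) (QP.+-identityˡ _)

Σ≡0 : ∀ N f → (∀ i → 1 ≤ i → i ≤ N → f i ≡ 0ℚ) → Σ N f ≡ 0ℚ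
Σ≡0 N f h = trans (Σ-cong N h) (Σ-0 N)

Π≡0 : ∀ N k f → 1 ≤ k → k ≤ N → f k ≡ 0ℚ → Π N f ≡ 0ℚ
Π≡0 N k f a b e = trans (Π≡f*Π∖ N k f a b) (trans (cong (_* Π∖ N k f) e) (QP.*-zeroˡ (Π∖ N k f)))

Π∖≡0 : ∀ N j k f → 1 ≤ k → k ≤ N → k ≢ j → f k ≡ 0ℚ → Π∖ N j f ≡ 0ℚ
Π∖≡0 N zero k f a b _ e = trans (Π∖0≡Π N f) (Π≡0 N k f a b e)
Π∖≡0 (suc N) (suc zero) (suc zero) f _ _ k≢j e = ⊥-elim (k≢j refl)
Π∖≡0 (suc N) (suc zero) (suc (suc k)) f _ (s≤s b) k≢j e = Π≡0 N (suc k) (λ i → f (suc i)) (s≤s z≤n) b e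
Π∖≡0 (suc N) (suc (suc j)) (suc zero) f _ _ k≢j e = trans (cong (_* Π∖ N (suc j) (λ i → f (suc i))) e) (QP.*-zeroˡ (Π∖ N (suc j) (λ i → f (suc i))))
Π∖≡0 (suc N) (suc (suc j)) (suc (suc k)) f _ (s≤s b) k≢j e =
  trans (cong (f 1 *_) (Π∖≡0 N (suc j) (suc k) (λ i → f (suc i)) (s≤s z≤n) b (λ x → k≢j (cong suc x)) e)) (QP.*-zeroʳ (f 1))

Π∖-cong′ : ∀ N k {f g : ℕ → ℚ} → (∀ i → 1 ≤ i → i ≤ N → i ≢ k → f i ≡ g i) → Π∖ N k f ≡ Π∖ N k g
Π∖-cong′ zero k h = refl
Π∖-cong′ (suc N) zero h = cong₂ _*_ (h 1 (s≤s z≤n) (s≤s z≤n) (λ ()))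
  (Π∖-cong′ N zero (λ i _ b ne → h (suc i) (s≤s z≤n) (s≤s b) (λ ())))
Π∖-cong′ (suc N) (suc zero) h = Π-cong N (λ i a b → h (suc i) (s≤s z≤n) (s≤s b) (λ e → NP.<⇒≢ a (sym (NP.suc-injective e))))
Π∖-cong′ (suc N) (suc (suc k)) h = cong₂ _*_ (h 1 (s≤s z≤n) (s≤s z≤n) (λ ()))
  (Π∖-cong′ N (suc k) (λ i _ b ne → h (suc i) (s≤s z≤n) (s≤s b) (λ e → ne (NP.suc-injective e))))

Π∖-last : ∀ m k f → 1 ≤ k → k ≤ m → Π∖ (suc m) k f ≡ Π∖ m k f * f (suc m)
Π∖-last (suc m) (suc zero) f _ _ = Π-last m (λ i → f (suc i))
Π∖-last (suc m) (suc (suc k)) f _ (s≤s le) = trans (cong (f 1 *_) (Π∖-last m (suc k) (λ i → f (suc i)) (s≤s z≤n) le))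
  (sym (QP.*-assoc (f 1) (Π∖ m (suc k) (λ i → f (suc i))) (f (suc (suc m)))))

Σ-split : ∀ d t f → Σ (d ℕ.+ t) f ≡ Σ d f + Σ t (λ i → f (d ℕ.+ i))
Σ-split zero t f = sym (QP.+-identityˡ _)
Σ-split (suc d) t f = trans (cong (f 1 +_) (Σ-split d t (λ i → f (suc i))))
  (sym (QP.+-assoc (f 1) (Σ d (λ i → f (suc i))) (Σ t (λ i → f (suc (d ℕ.+ i))))))

Σ-sub : ∀ N f h → Σ N (λ i → f i - h i) ≡ Σ N f - Σ N h
Σ-sub zero f h = refl
Σ-sub (suc N) f h = trans (cong (f 1 - h 1 +_) (Σ-sub N (λ i → f (suc i)) (λ i → h (suc i))))
  (solve 4 (λ a b c d → a :- b :+ (c :- d) := a :+ c :- (b :+ d)) refl (f 1) (h 1) (Σ N (λ i → f (suc i))) (Σ N (λ i → h (suc i))))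

Σ-1+ : ∀ N a → Σ N (λ i → 1ℚ + a i) ≡ ι N + Σ N a
Σ-1+ N a = trans (Σ-+ N (λ _ → 1ℚ) a) (cong (_+ Σ N a) (Σ-1 N))

δ : ℕ → ℕ → ℚ
δ k i with i ℕ.≟ k
... | yes _ = 1ℚ
... | no _ = 0ℚ

δ-refl : ∀ k → δ k k ≡ 1ℚ
δ-refl k with k ℕ.≟ k
... | yes _ = refl
... | no ne = ⊥-elim (ne refl)

δ-ne : ∀ k i → i ≢ k → δ k i ≡ 0ℚ
δ-ne k i ne with i ℕ.≟ k
... | yes e = ⊥-elim (ne e)
... | no _ = refl

-- Polynomials as coefficient lists

Poly : Set
Poly = List ℚ

eval : Poly → ℚ → ℚ
eval [] z = 0ℚ
eval (a ∷ p) z = a + z * eval p z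

coeff : Poly → ℕ → ℚ
coeff [] j = 0ℚ
coeff (a ∷ p) zero = a
coeff (a ∷ p) (suc j) = coeff p j

infixl 6 _⊕_
_⊕_ : Poly → Poly → Poly
[] ⊕ q = q
(a ∷ p) ⊕ [] = a ∷ p
(a ∷ p) ⊕ (b ∷ q) = (a + b) ∷ (p ⊕ q)

infixl 7 _⊙_
_⊙_ : ℚ → Poly → Poly
c ⊙ [] = []
c ⊙ (a ∷ p) = (c * a) ∷ (c ⊙ p)

⊕-eval : ∀ p q z → eval (p ⊕ q) z ≡ eval p z + eval q z
⊕-eval [] q z = sym (QP.+-identityˡ _)
⊕-eval (a ∷ p) [] z = sym (QP.+-identityʳ _)
⊕-eval (a ∷ p) (b ∷ q) z = trans (cong (λ t → a + b + z * t) (⊕-eval p q z))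
  (solve 5 (λ a b z P Q → a :+ b :+ z :* (P :+ Q) := a :+ z :* P :+ (b :+ z :* Q)) refl a b z (eval p z) (eval q z))

⊙-eval : ∀ c p z → eval (c ⊙ p) z ≡ c * eval p z
⊙-eval c [] z = sym (QP.*-zeroʳ c)
⊙-eval c (a ∷ p) z = trans (cong (λ t → c * a + z * t) (⊙-eval c p z))
  (solve 4 (λ c a z P → c :* a :+ z :* (c :* P) := c :* (a :+ z :* P)) refl c a z (eval p z))

⊕-coeff : ∀ p q j → coeff (p ⊕ q) j ≡ coeff p j + coeff q j
⊕-coeff [] q j = sym (QP.+-identityˡ _)
⊕-coeff (a ∷ p) [] j = sym (QP.+-identityʳ _)
⊕-coeff (a ∷ p) (b ∷ q) zero = refl
⊕-coeff (a ∷ p) (b ∷ q) (suc j) = ⊕-coeff p q j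

⊙-coeff : ∀ c p j → coeff (c ⊙ p) j ≡ c * coeff p j
⊙-coeff c [] j = sym (QP.*-zeroʳ c)
⊙-coeff c (a ∷ p) zero = refl
⊙-coeff c (a ∷ p) (suc j) = ⊙-coeff c p j

coeff≡0⇒eval≡0 : ∀ p → (∀ j → coeff p j ≡ 0ℚ) → ∀ z → eval p z ≡ 0ℚ
coeff≡0⇒eval≡0 [] h z = refl
coeff≡0⇒eval≡0 (a ∷ p) h z = trans (cong₂ (λ u v → u + z * v) (h 0) (coeff≡0⇒eval≡0 p (λ j → h (suc j)) z))
  (solve 1 (λ z → con 0ℚ :+ z :* con 0ℚ := con 0ℚ) refl z)

-- Synthetic division: the quotient of p by z − r.
quot : ℚ → Poly → Poly
quot r [] = []
quot r (a ∷ p) = p ⊕ r ⊙ quot r p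

quot-eval : ∀ r p z → eval p z ≡ (z - r) * eval (quot r p) z + eval p r
quot-eval r [] z = solve 2 (λ z r → con 0ℚ := (z :- r) :* con 0ℚ :+ con 0ℚ) refl z r
quot-eval r (a ∷ p) z = begin
  a + z * eval p z ≡⟨ cong (λ t → a + z * t) (quot-eval r p z) ⟩
  a + z * ((z - r) * Q + Pr) ≡⟨ solve 5 (λ a z r Q Pr → a :+ z :* ((z :- r) :* Q :+ Pr) :=
       (z :- r) :* ((z :- r) :* Q :+ Pr :+ r :* Q) :+ (a :+ r :* Pr)) refl a z r Q Pr ⟩
  (z - r) * ((z - r) * Q + Pr + r * Q) + (a + r * Pr) ≡⟨ cong (λ t → (z - r) * (t + r * Q) + (a + r * Pr)) (sym (quot-eval r p z)) ⟩
  (z - r) * (eval p z + r * Q) + (a + r * Pr) ≡⟨ cong (λ t → (z - r) * t + (a + r * Pr))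
       (sym (trans (⊕-eval p (r ⊙ quot r p) z) (cong (eval p z +_) (⊙-eval r (quot r p) z)))) ⟩
  (z - r) * eval (p ⊕ r ⊙ quot r p) z + (a + r * Pr) ∎
  where open ≡-Reasoning
        Q = eval (quot r p) z
        Pr = eval p r

quot-coeff : ∀ r a p j → coeff (quot r (a ∷ p)) j ≡ coeff p j + r * coeff (quot r p) j
quot-coeff r a p j = trans (⊕-coeff p (r ⊙ quot r p) j) (cong (coeff p j +_) (⊙-coeff r (quot r p) j))

quot-shift : ∀ r a p j → coeff (quot r (a ∷ p)) (suc j) ≡ coeff (quot r p) j
quot-shift r a [] j = trans (quot-coeff r a [] (suc j)) (solve 1 (λ r → con 0ℚ :+ r :* con 0ℚ := con 0ℚ) refl r)
quot-shift r a (b ∷ p) j = trans (quot-coeff r a (b ∷ p) (suc j))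
  (trans (cong (coeff p j +_) (cong (r *_) (quot-shift r b p j))) (sym (quot-coeff r b p j)))

quot-deg : ∀ r p m → (∀ j → m ≤ j → coeff p (suc j) ≡ 0ℚ) → ∀ j → m ≤ j → coeff (quot r p) j ≡ 0ℚ
quot-deg r [] m h j _ = refl
quot-deg r (a ∷ p) m h j m≤j = trans (quot-coeff r a p j)
  (trans (cong₂ (λ u v → u + r * v) (h j m≤j)
     (quot-deg r p m (λ j' m≤j' → h (suc j') (NP.m≤n⇒m≤1+n m≤j')) j m≤j))
   (solve 1 (λ r → con 0ℚ :+ r :* con 0ℚ := con 0ℚ) refl r))

coeff-via-quot : ∀ r a p j → coeff p j ≡ coeff (quot r (a ∷ p)) j - r * coeff (quot r (a ∷ p)) (suc j)
coeff-via-quot r a p j = begin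
  coeff p j ≡⟨ solve 2 (λ c d → c := c :+ d :- d) refl (coeff p j) (r * coeff (quot r p) j) ⟩
  coeff p j + r * coeff (quot r p) j - r * coeff (quot r p) j
    ≡⟨ cong₂ _-_ (sym (quot-coeff r a p j)) (cong (r *_) (sym (quot-shift r a p j))) ⟩
  coeff (quot r (a ∷ p)) j - r * coeff (quot r (a ∷ p)) (suc j) ∎
  where open ≡-Reasoning

quot≡0⇒coeff≡0 : ∀ r p → (∀ j → coeff (quot r p) j ≡ 0ℚ) → eval p r ≡ 0ℚ → ∀ j → coeff p j ≡ 0ℚ
quot≡0⇒coeff≡0 r [] hq hr j = refl
quot≡0⇒coeff≡0 r (a ∷ p) hq hr = λ { zero → head≡0 ; (suc j) → tail≡0 j }
  where
  open ≡-Reasoning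
  tail≡0 : ∀ j → coeff p j ≡ 0ℚ
  tail≡0 j = begin
    coeff p j ≡⟨ coeff-via-quot r a p j ⟩
    coeff (quot r (a ∷ p)) j - r * coeff (quot r (a ∷ p)) (suc j) ≡⟨ cong₂ (λ u v → u - r * v) (hq j) (hq (suc j)) ⟩
    0ℚ - r * 0ℚ ≡⟨ solve 1 (λ r → con 0ℚ :- r :* con 0ℚ := con 0ℚ) refl r ⟩
    0ℚ ∎
  head≡0 : a ≡ 0ℚ
  head≡0 = begin
    a ≡⟨ solve 3 (λ a r P → a := a :+ r :* P :- r :* P) refl a r (eval p r) ⟩
    a + r * eval p r - r * eval p r ≡⟨ cong₂ (λ u v → u - r * v) hr (coeff≡0⇒eval≡0 p tail≡0 r) ⟩
    0ℚ - r * 0ℚ ≡⟨ solve 1 (λ r → con 0ℚ :- r :* con 0ℚ := con 0ℚ) refl r ⟩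
    0ℚ ∎

Distinct : ℕ → (ℕ → ℚ) → Set
Distinct N a = ∀ i j → 1 ≤ i → i ≤ N → 1 ≤ j → j ≤ N → i ≢ j → a i ≢ a j

Distinct-neg : ∀ N a → Distinct N a → Distinct N (λ i → - a i)
Distinct-neg N a d i j a1 a2 a3 a4 ne e = d i j a1 a2 a3 a4 ne (QP.neg-injective e)

Distinct-weaken : ∀ N a → Distinct (suc N) a → Distinct N a
Distinct-weaken N a d i j h1 h2 h3 h4 ne = d i j h1 (NP.m≤n⇒m≤1+n h2) h3 (NP.m≤n⇒m≤1+n h4) ne

roots⇒coeff≡0 : ∀ M (rt : ℕ → ℚ) p → Distinct M rt →
  (∀ k → 1 ≤ k → k ≤ M → eval p (rt k) ≡ 0ℚ) →
  (∀ j → M ≤ j → coeff p j ≡ 0ℚ) →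
  ∀ j → coeff p j ≡ 0ℚ
roots⇒coeff≡0 zero rt p dist roots deg j = deg j z≤n
roots⇒coeff≡0 (suc M) rt p dist roots deg = quot≡0⇒coeff≡0 r1 p qzero (roots 1 (s≤s z≤n) (s≤s z≤n))
  where
  r1 = rt 1
  q = quot r1 p
  qdeg : ∀ j → M ≤ j → coeff q j ≡ 0ℚ
  qdeg = quot-deg r1 p M (λ j M≤j → deg (suc j) (s≤s M≤j))
  qroots : ∀ k → 1 ≤ k → k ≤ M → eval q (rt (suc k)) ≡ 0ℚ
  qroots k 1≤k k≤M = *-cancelˡ-≡ (rt (suc k) - r1) d≢0 (trans
      (solve 3 (λ a b c → a :* b := a :* b :+ c :- c) refl (rt (suc k) - r1) (eval q (rt (suc k))) (eval p r1))
      (trans (cong₂ _-_ (sym (quot-eval r1 p (rt (suc k)))) (roots 1 (s≤s z≤n) (s≤s z≤n)))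
      (trans (cong (_- 0ℚ) (roots (suc k) (s≤s z≤n) (s≤s k≤M)))
       (solve 1 (λ d → con 0ℚ :- con 0ℚ := d :* con 0ℚ) refl (rt (suc k) - r1)))))
    where
    d≢0 : rt (suc k) - r1 ≢ 0ℚ
    d≢0 e = dist (suc k) 1 (s≤s z≤n) (s≤s k≤M) (s≤s z≤n) (s≤s z≤n) (λ e' → NP.<⇒≢ 1≤k (sym (NP.suc-injective e')))
      (trans (solve 2 (λ a b → a := a :- b :+ b) refl (rt (suc k)) r1)
        (trans (cong (_+ r1) e) (QP.+-identityˡ r1)))
  qzero : ∀ j → coeff q j ≡ 0ℚ
  qzero = roots⇒coeff≡0 M (λ i → rt (suc i)) q
    (λ i j a b c d i≢j → dist (suc i) (suc j) (s≤s z≤n) (s≤s b) (s≤s z≤n) (s≤s d) (λ e → i≢j (NP.suc-injective e)))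
    qroots qdeg

mulLinear : ℚ → Poly → Poly
mulLinear a p = a ⊙ p ⊕ (0ℚ ∷ p)

mulLinear-eval : ∀ a p z → eval (mulLinear a p) z ≡ (z + a) * eval p z
mulLinear-eval a p z = trans (⊕-eval (a ⊙ p) (0ℚ ∷ p) z) (trans (cong (_+ (0ℚ + z * eval p z)) (⊙-eval a p z))
  (solve 3 (λ a z P → a :* P :+ (con 0ℚ :+ z :* P) := (z :+ a) :* P) refl a z (eval p z)))

mulLinear-coeff0 : ∀ a p → coeff (mulLinear a p) 0 ≡ a * coeff p 0
mulLinear-coeff0 a p = trans (⊕-coeff (a ⊙ p) (0ℚ ∷ p) 0) (trans (cong (_+ 0ℚ) (⊙-coeff a p 0)) (QP.+-identityʳ (a * coeff p 0)))

mulLinear-coeff-suc : ∀ a p j → coeff (mulLinear a p) (suc j) ≡ a * coeff p (suc j) + coeff p j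
mulLinear-coeff-suc a p j = trans (⊕-coeff (a ⊙ p) (0ℚ ∷ p) (suc j)) (cong (_+ coeff p j) (⊙-coeff a p (suc j)))

linProd : ℕ → (ℕ → ℚ) → Poly
linProd zero f = 1ℚ ∷ []
linProd (suc N) f = mulLinear (f 1) (linProd N (λ i → f (suc i)))

linProd-eval : ∀ N f z → eval (linProd N f) z ≡ Π N (λ i → z + f i)
linProd-eval zero f z = solve 1 (λ z → con 1ℚ :+ z :* con 0ℚ := con 1ℚ) refl z
linProd-eval (suc N) f z = trans (mulLinear-eval (f 1) (linProd N (λ i → f (suc i))) z)
  (cong ((z + f 1) *_) (linProd-eval N (λ i → f (suc i)) z))

linProd-coeff-above : ∀ N f j → N < j → coeff (linProd N f) j ≡ 0ℚ
linProd-coeff-above zero f (suc j) _ = refl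
linProd-coeff-above (suc N) f (suc j) (s≤s N<j) = trans (mulLinear-coeff-suc (f 1) (linProd N (λ i → f (suc i))) j)
  (trans (cong₂ (λ u v → f 1 * u + v) (linProd-coeff-above N (λ i → f (suc i)) (suc j) (NP.m≤n⇒m≤1+n N<j))
     (linProd-coeff-above N (λ i → f (suc i)) j N<j))
    (solve 1 (λ a → a :* con 0ℚ :+ con 0ℚ := con 0ℚ) refl (f 1)))

linProd-coeff-top : ∀ N f → coeff (linProd N f) N ≡ 1ℚ
linProd-coeff-top zero f = refl
linProd-coeff-top (suc N) f = trans (mulLinear-coeff-suc (f 1) (linProd N (λ i → f (suc i))) N)
  (trans (cong₂ (λ u v → f 1 * u + v) (linProd-coeff-above N (λ i → f (suc i)) (suc N) (NP.n<1+n N))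
     (linProd-coeff-top N (λ i → f (suc i))))
    (solve 1 (λ a → a :* con 0ℚ :+ con 1ℚ := con 1ℚ) refl (f 1)))

linProd-coeff-e₁ : ∀ N f → coeff (linProd (suc N) f) N ≡ Σ (suc N) f
linProd-coeff-e₁ zero f = trans (mulLinear-coeff0 (f 1) (1ℚ ∷ [])) (solve 1 (λ a → a :* con 1ℚ := a :+ con 0ℚ) refl (f 1))
linProd-coeff-e₁ (suc N) f = trans (mulLinear-coeff-suc (f 1) (linProd (suc N) (λ i → f (suc i))) N)
  (trans (cong₂ (λ u v → f 1 * u + v) (linProd-coeff-top (suc N) (λ i → f (suc i))) (linProd-coeff-e₁ N (λ i → f (suc i))))
    (cong (_+ Σ (suc N) (λ i → f (suc i))) (QP.*-identityʳ (f 1))))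

e₂ : ℕ → (ℕ → ℚ) → ℚ
e₂ zero f = 0ℚ
e₂ (suc N) f = f 1 * Σ N (λ i → f (suc i)) + e₂ N (λ i → f (suc i))

linProd-coeff-e₂ : ∀ N f → coeff (linProd (suc (suc N)) f) N ≡ e₂ (suc (suc N)) f
linProd-coeff-e₂ zero f = trans (mulLinear-coeff0 (f 1) (linProd 1 (λ i → f (suc i))))
  (trans (cong (f 1 *_) (linProd-coeff-e₁ zero (λ i → f (suc i))))
  (solve 2 (λ a b → a :* (b :+ con 0ℚ) := a :* (b :+ con 0ℚ) :+ (b :* con 0ℚ :+ con 0ℚ)) refl (f 1) (f 2)))
linProd-coeff-e₂ (suc N) f = trans (mulLinear-coeff-suc (f 1) (linProd (suc (suc N)) (λ i → f (suc i))) N)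
  (cong₂ (λ u v → f 1 * u + v) (linProd-coeff-e₁ (suc N) (λ i → f (suc i))) (linProd-coeff-e₂ N (λ i → f (suc i))))

ΣPoly : ℕ → (ℕ → Poly) → Poly
ΣPoly zero F = []
ΣPoly (suc N) F = F 1 ⊕ ΣPoly N (λ i → F (suc i))

ΣPoly-eval : ∀ N F z → eval (ΣPoly N F) z ≡ Σ N (λ k → eval (F k) z)
ΣPoly-eval zero F z = refl
ΣPoly-eval (suc N) F z = trans (⊕-eval (F 1) (ΣPoly N (λ i → F (suc i))) z) (cong (eval (F 1) z +_) (ΣPoly-eval N (λ i → F (suc i)) z))

ΣPoly-coeff : ∀ N F j → coeff (ΣPoly N F) j ≡ Σ N (λ k → coeff (F k) j)
ΣPoly-coeff zero F j = refl
ΣPoly-coeff (suc N) F j = trans (⊕-coeff (F 1) (ΣPoly N (λ i → F (suc i))) j) (cong (coeff (F 1) j +_) (ΣPoly-coeff N (λ i → F (suc i)) j))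

linProd∖ : ℕ → ℕ → (ℕ → ℚ) → Poly
linProd∖ zero k f = 1ℚ ∷ []
linProd∖ (suc N) zero f = mulLinear (f 1) (linProd∖ N zero (λ i → f (suc i)))
linProd∖ (suc N) (suc zero) f = linProd N (λ i → f (suc i))
linProd∖ (suc N) (suc (suc k)) f = mulLinear (f 1) (linProd∖ N (suc k) (λ i → f (suc i)))

linProd∖-eval : ∀ N k f z → eval (linProd∖ N k f) z ≡ Π∖ N k (λ i → z + f i)
linProd∖-eval zero k f z = solve 1 (λ z → con 1ℚ :+ z :* con 0ℚ := con 1ℚ) refl z
linProd∖-eval (suc N) zero f z = trans (mulLinear-eval (f 1) (linProd∖ N zero (λ i → f (suc i))) z)
  (cong ((z + f 1) *_) (linProd∖-eval N zero (λ i → f (suc i)) z))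
linProd∖-eval (suc N) (suc zero) f z = linProd-eval N (λ i → f (suc i)) z
linProd∖-eval (suc N) (suc (suc k)) f z = trans (mulLinear-eval (f 1) (linProd∖ N (suc k) (λ i → f (suc i))) z)
  (cong ((z + f 1) *_) (linProd∖-eval N (suc k) (λ i → f (suc i)) z))

linProd∖-coeff-above : ∀ M k f j → 1 ≤ k → k ≤ suc M → M < j → coeff (linProd∖ (suc M) k f) j ≡ 0ℚ
linProd∖-coeff-above M (suc zero) f j _ _ M<j = linProd-coeff-above M (λ i → f (suc i)) j M<j
linProd∖-coeff-above (suc M) (suc (suc k)) f (suc j) _ (s≤s k≤) (s≤s M<j) =
  trans (mulLinear-coeff-suc (f 1) (linProd∖ (suc M) (suc k) (λ i → f (suc i))) j)
  (trans (cong₂ (λ u v → f 1 * u + v) (linProd∖-coeff-above M (suc k) (λ i → f (suc i)) (suc j) (s≤s z≤n) k≤ (NP.m≤n⇒m≤1+n M<j))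
     (linProd∖-coeff-above M (suc k) (λ i → f (suc i)) j (s≤s z≤n) k≤ M<j))
    (solve 1 (λ a → a :* con 0ℚ :+ con 0ℚ := con 0ℚ) refl (f 1)))

linProd∖-coeff-top : ∀ M k f → 1 ≤ k → k ≤ suc M → coeff (linProd∖ (suc M) k f) M ≡ 1ℚ
linProd∖-coeff-top M (suc zero) f _ _ = linProd-coeff-top M (λ i → f (suc i))
linProd∖-coeff-top (suc M) (suc (suc k)) f _ (s≤s k≤) =
  trans (mulLinear-coeff-suc (f 1) (linProd∖ (suc M) (suc k) (λ i → f (suc i))) M)
  (trans (cong₂ (λ u v → f 1 * u + v) (linProd∖-coeff-above M (suc k) (λ i → f (suc i)) (suc M) (s≤s z≤n) k≤ (NP.n<1+n M))
     (linProd∖-coeff-top M (suc k) (λ i → f (suc i)) (s≤s z≤n) k≤))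
    (solve 1 (λ a → a :* con 0ℚ :+ con 1ℚ := con 1ℚ) refl (f 1)))

linProd-shift-coeff-e₂ : ∀ M f → coeff (0ℚ ∷ linProd (suc M) f) M ≡ e₂ (suc M) f
linProd-shift-coeff-e₂ zero f = solve 1 (λ a → con 0ℚ := a :* con 0ℚ :+ con 0ℚ) refl (f 1)
linProd-shift-coeff-e₂ (suc M) f = linProd-coeff-e₂ M f

binom₂ : ℕ → ℚ
binom₂ N = e₂ N (λ _ → 1ℚ)

e₂-shift : ∀ N f → e₂ N (λ i → 1ℚ + f i) ≡ e₂ N f + (ι N - 1ℚ) * Σ N f + binom₂ N
e₂-shift zero f = refl
e₂-shift (suc N) f = begin
  (1ℚ + f 1) * Σ N (λ i → 1ℚ + f (suc i)) + e₂ N (λ i → 1ℚ + f (suc i))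
    ≡⟨ cong₂ (λ u v → (1ℚ + f 1) * u + v) (Σ-1+ N (λ i → f (suc i))) (e₂-shift N (λ i → f (suc i))) ⟩
  (1ℚ + f 1) * (ι N + S') + (E' + (ι N - 1ℚ) * S' + binom₂ N)
    ≡⟨ solve 5 (λ f1 S E n C → (con 1ℚ :+ f1) :* (n :+ S) :+ (E :+ (n :- con 1ℚ) :* S :+ C) :=
          (f1 :* S :+ E) :+ (n :+ con 1ℚ :- con 1ℚ) :* (f1 :+ S) :+ (con 1ℚ :* n :+ C)) refl (f 1) S' E' (ι N) (binom₂ N) ⟩
  (f 1 * S' + E') + (ι N + 1ℚ - 1ℚ) * (f 1 + S') + (1ℚ * ι N + binom₂ N)
    ≡⟨ cong₂ (λ u v → (f 1 * S' + E') + (u - 1ℚ) * (f 1 + S') + (1ℚ * v + binom₂ N)) (sym (ι-suc N)) (sym (Σ-1 N)) ⟩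
  (f 1 * S' + E') + (ι (suc N) - 1ℚ) * (f 1 + S') + (1ℚ * Σ N (λ _ → 1ℚ) + binom₂ N) ∎
  where open ≡-Reasoning
        S' = Σ N (λ i → f (suc i))
        E' = e₂ N (λ i → f (suc i))

Σι+binom₂≡square : ∀ N → Σ N ι + binom₂ N ≡ ι N * ι N
Σι+binom₂≡square zero = refl
Σι+binom₂≡square (suc N) = begin
  ι 1 + Σ N (λ i → ι (suc i)) + (1ℚ * Σ N (λ _ → 1ℚ) + binom₂ N)
    ≡⟨ cong₂ (λ u v → ι 1 + u + (1ℚ * v + binom₂ N))
         (trans (Σ-cong N (λ i _ _ → trans (ι-suc i) (QP.+-comm (ι i) 1ℚ))) (Σ-1+ N ι)) (Σ-1 N) ⟩
  1ℚ + (ι N + Σ N ι) + (1ℚ * ι N + binom₂ N)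
    ≡⟨ solve 3 (λ n S C → con 1ℚ :+ (n :+ S) :+ (con 1ℚ :* n :+ C) := (S :+ C) :+ (n :+ n :+ con 1ℚ)) refl (ι N) (Σ N ι) (binom₂ N) ⟩
  (Σ N ι + binom₂ N) + (ι N + ι N + 1ℚ) ≡⟨ cong (_+ (ι N + ι N + 1ℚ)) (Σι+binom₂≡square N) ⟩
  ι N * ι N + (ι N + ι N + 1ℚ) ≡⟨ solve 1 (λ n → n :* n :+ (n :+ n :+ con 1ℚ) := (n :+ con 1ℚ) :* (n :+ con 1ℚ)) refl (ι N) ⟩
  (ι N + 1ℚ) * (ι N + 1ℚ) ≡⟨ cong (λ u → u * u) (sym (ι-suc N)) ⟩
  ι (suc N) * ι (suc N) ∎
  where open ≡-Reasoning

-- p = N P1 − z P1 + z P0 − Σₖ cₖ Qₖ has degree < N and vanishes at −a₁, …, −a_N by the hypothesis,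
-- so p = 0; its coefficient of z^M is the identity for Σ c.
module ResidueSum (M : ℕ) (a c : ℕ → ℚ) (dist : Distinct (suc M) a)
  (hyp : ∀ k → 1 ≤ k → k ≤ suc M → c k * Π∖ (suc M) k (λ i → a i - a k) ≡ (ι (suc M) + a k) * Π (suc M) (λ i → 1ℚ + a i - a k)) where
  N : ℕ
  N = suc M
  P1 P0 : Poly
  P1 = linProd N (λ i → 1ℚ + a i)
  P0 = linProd N a
  Qk : ℕ → Poly
  Qk k = linProd∖ N k a
  S T2 T1 p : Poly
  S = ΣPoly N (λ k → c k ⊙ Qk k)
  T2 = (0ℚ ∷ P0) ⊕ (-1ℚ ⊙ S)
  T1 = (-1ℚ ⊙ (0ℚ ∷ P1)) ⊕ T2
  p = (ι N ⊙ P1) ⊕ T1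

  coeff-p : ∀ j → coeff p j ≡ ι N * coeff P1 j + (-1ℚ * coeff (0ℚ ∷ P1) j + (coeff (0ℚ ∷ P0) j + -1ℚ * Σ N (λ k → c k * coeff (Qk k) j)))
  coeff-p j = trans (⊕-coeff (ι N ⊙ P1) T1 j) (cong₂ _+_ (⊙-coeff (ι N) P1 j)
    (trans (⊕-coeff (-1ℚ ⊙ (0ℚ ∷ P1)) T2 j) (cong₂ _+_ (⊙-coeff -1ℚ (0ℚ ∷ P1) j)
      (trans (⊕-coeff (0ℚ ∷ P0) (-1ℚ ⊙ S) j) (cong (coeff (0ℚ ∷ P0) j +_)
        (trans (⊙-coeff -1ℚ S j) (cong (-1ℚ *_) (trans (ΣPoly-coeff N (λ k → c k ⊙ Qk k) j)
          (Σ-cong N (λ k _ _ → ⊙-coeff (c k) (Qk k) j))))))))))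

  eval-p : ∀ z → eval p z ≡ ι N * eval P1 z + (-1ℚ * (0ℚ + z * eval P1 z) + ((0ℚ + z * eval P0 z) + -1ℚ * Σ N (λ k → c k * eval (Qk k) z)))
  eval-p z = trans (⊕-eval (ι N ⊙ P1) T1 z) (cong₂ _+_ (⊙-eval (ι N) P1 z)
    (trans (⊕-eval (-1ℚ ⊙ (0ℚ ∷ P1)) T2 z) (cong₂ _+_ (⊙-eval -1ℚ (0ℚ ∷ P1) z)
      (trans (⊕-eval (0ℚ ∷ P0) (-1ℚ ⊙ S) z) (cong (eval (0ℚ ∷ P0) z +_)
        (trans (⊙-eval -1ℚ S z) (cong (-1ℚ *_) (trans (ΣPoly-eval N (λ k → c k ⊙ Qk k) z)
          (Σ-cong N (λ k _ _ → ⊙-eval (c k) (Qk k) z))))))))))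

  ΣQ-above : ∀ j → M < j → Σ N (λ k → c k * coeff (Qk k) j) ≡ 0ℚ
  ΣQ-above j M<j = Σ≡0 N _ (λ k h1 h2 → trans (cong (c k *_) (linProd∖-coeff-above M k a j h1 h2 M<j)) (QP.*-zeroʳ (c k)))

  ΣQ-top : Σ N (λ k → c k * coeff (Qk k) M) ≡ Σ N c
  ΣQ-top = Σ-cong N (λ k h1 h2 → trans (cong (c k *_) (linProd∖-coeff-top M k a h1 h2)) (QP.*-identityʳ (c k)))

  coeff-beyond : ∀ t → coeff p (suc (M ℕ.+ t)) ≡ 0ℚ
  coeff-beyond zero rewrite NP.+-identityʳ M = trans (coeff-p (suc M))
    (trans (cong₂ (λ u v → ι N * u + (-1ℚ * v + (coeff P0 M + -1ℚ * Σ N (λ k → c k * coeff (Qk k) (suc M)))))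
       (linProd-coeff-top N (λ i → 1ℚ + a i)) (trans (linProd-coeff-e₁ M (λ i → 1ℚ + a i)) (Σ-1+ N a)))
    (trans (cong₂ (λ u v → ι N * 1ℚ + (-1ℚ * (ι N + Σ N a) + (u + -1ℚ * v))) (linProd-coeff-e₁ M a) (ΣQ-above (suc M) (NP.n<1+n M)))
      (solve 2 (λ n s → n :* con 1ℚ :+ (con -1ℚ :* (n :+ s) :+ (s :+ con -1ℚ :* con 0ℚ)) := con 0ℚ) refl (ι N) (Σ N a))))
  coeff-beyond (suc zero) rewrite NP.+-comm M 1 = trans (coeff-p (suc (suc M)))
    (trans (cong₂ (λ u v → ι N * u + (-1ℚ * v + (coeff P0 N + -1ℚ * Σ N (λ k → c k * coeff (Qk k) (suc (suc M))))))
       (linProd-coeff-above N (λ i → 1ℚ + a i) (suc (suc M)) (NP.n<1+n N)) (linProd-coeff-top N (λ i → 1ℚ + a i)))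
    (trans (cong₂ (λ u v → ι N * 0ℚ + (-1ℚ * 1ℚ + (u + -1ℚ * v))) (linProd-coeff-top N a) (ΣQ-above (suc (suc M)) (NP.m≤n⇒m≤1+n (NP.n<1+n M))))
      (solve 1 (λ n → n :* con 0ℚ :+ (con -1ℚ :* con 1ℚ :+ (con 1ℚ :+ con -1ℚ :* con 0ℚ)) := con 0ℚ) refl (ι N))))
  coeff-beyond (suc (suc t)) = trans (coeff-p (suc (M ℕ.+ suc (suc t))))
    (trans (cong₂ (λ u v → ι N * u + (-1ℚ * v + (coeff (0ℚ ∷ P0) (suc (M ℕ.+ suc (suc t))) + -1ℚ * Σ N (λ k → c k * coeff (Qk k) (suc (M ℕ.+ suc (suc t)))))))
       (linProd-coeff-above N (λ i → 1ℚ + a i) _ lt1) (linProd-coeff-above N (λ i → 1ℚ + a i) (M ℕ.+ suc (suc t)) lt2))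
    (trans (cong₂ (λ u v → ι N * 0ℚ + (-1ℚ * 0ℚ + (u + -1ℚ * v))) (linProd-coeff-above N a (M ℕ.+ suc (suc t)) lt2) (ΣQ-above (suc (M ℕ.+ suc (suc t))) lt3))
      (solve 1 (λ n → n :* con 0ℚ :+ (con -1ℚ :* con 0ℚ :+ (con 0ℚ :+ con -1ℚ :* con 0ℚ)) := con 0ℚ) refl (ι N))))
    where
    lt2 : N < M ℕ.+ suc (suc t)
    lt2 = NP.≤-trans (s≤s (s≤s (NP.m≤m+n M t))) (NP.≤-reflexive (sym (trans (NP.+-suc M (suc t)) (cong suc (NP.+-suc M t)))))
    lt1 : N < suc (M ℕ.+ suc (suc t))
    lt1 = NP.m≤n⇒m≤1+n lt2
    lt3 : M < suc (M ℕ.+ suc (suc t))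
    lt3 = s≤s (NP.m≤m+n M _)

  deg : ∀ j → N ≤ j → coeff p j ≡ 0ℚ
  deg j N≤j = subst (λ j → coeff p j ≡ 0ℚ) (NP.m+[n∸m]≡n N≤j) (coeff-beyond (j ℕ.∸ N))

  roots : ∀ k → 1 ≤ k → k ≤ N → eval p (- a k) ≡ 0ℚ
  roots k h1 h2 = begin
    eval p z ≡⟨ eval-p z ⟩
    ι N * eval P1 z + (-1ℚ * (0ℚ + z * eval P1 z) + ((0ℚ + z * eval P0 z) + -1ℚ * Σ N (λ j → c j * eval (Qk j) z)))
      ≡⟨ cong₂ (λ u v → ι N * u + (-1ℚ * (0ℚ + z * u) + ((0ℚ + z * v) + -1ℚ * Σ N (λ j → c j * eval (Qk j) z)))) e1 e0 ⟩
    ι N * Π1 + (-1ℚ * (0ℚ + z * Π1) + ((0ℚ + z * 0ℚ) + -1ℚ * Σ N (λ j → c j * eval (Qk j) z)))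
      ≡⟨ cong (λ u → ι N * Π1 + (-1ℚ * (0ℚ + z * Π1) + ((0ℚ + z * 0ℚ) + -1ℚ * u))) es ⟩
    ι N * Π1 + (-1ℚ * (0ℚ + z * Π1) + ((0ℚ + z * 0ℚ) + -1ℚ * (c k * Π∖ N k (λ i → a i - a k))))
      ≡⟨ cong (λ u → ι N * Π1 + (-1ℚ * (0ℚ + z * Π1) + ((0ℚ + z * 0ℚ) + -1ℚ * u))) (hyp k h1 h2) ⟩
    ι N * Π1 + (-1ℚ * (0ℚ + z * Π1) + ((0ℚ + z * 0ℚ) + -1ℚ * ((ι N + a k) * Π1)))
      ≡⟨ solve 3 (λ n ak P → n :* P :+ (con -1ℚ :* (con 0ℚ :+ (:- ak) :* P) :+ ((con 0ℚ :+ (:- ak) :* con 0ℚ) :+ con -1ℚ :* ((n :+ ak) :* P))) := con 0ℚ)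
           refl (ι N) (a k) Π1 ⟩
    0ℚ ∎
    where
    open ≡-Reasoning
    z = - a k
    Π1 = Π N (λ i → 1ℚ + a i - a k)
    e1 : eval P1 z ≡ Π1
    e1 = trans (linProd-eval N (λ i → 1ℚ + a i) z) (Π-cong N (λ i _ _ → solve 2 (λ ak ai → (:- ak) :+ (con 1ℚ :+ ai) := con 1ℚ :+ ai :- ak) refl (a k) (a i)))
    e0 : eval P0 z ≡ 0ℚ
    e0 = trans (linProd-eval N a z) (Π≡0 N k (λ i → z + a i) h1 h2 (QP.+-inverseˡ (a k)))
    es : Σ N (λ j → c j * eval (Qk j) z) ≡ c k * Π∖ N k (λ i → a i - a k)
    es = trans (Σ-single N k (λ j → c j * eval (Qk j) z) h1 h2
           (λ j j≢k → trans (cong (c j *_) (trans (linProd∖-eval N j a z)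
              (Π∖≡0 N j k (λ i → z + a i) h1 h2 (λ e → j≢k (sym e)) (QP.+-inverseˡ (a k))))) (QP.*-zeroʳ (c j))))
         (cong (c k *_) (trans (linProd∖-eval N k a z) (Π∖-cong N k (λ i _ _ → solve 2 (λ ak ai → (:- ak) :+ ai := ai :- ak) refl (a k) (a i)))))

  coeffs≡0 : ∀ j → coeff p j ≡ 0ℚ
  coeffs≡0 = roots⇒coeff≡0 N (λ k → - a k) p (Distinct-neg N a dist) roots deg

  Σc≡ : Σ N c ≡ ι N * ι N + Σ N a - binom₂ N
  Σc≡ = begin
    Σ N c ≡⟨ sym (QP.+-identityʳ (Σ N c)) ⟩
    Σ N c + 0ℚ ≡⟨ cong (Σ N c +_) (sym (trans (sym (coeff-p M)) (coeffs≡0 M))) ⟩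
    Σ N c + (ι N * coeff P1 M + (-1ℚ * coeff (0ℚ ∷ P1) M + (coeff (0ℚ ∷ P0) M + -1ℚ * Σ N (λ k → c k * coeff (Qk k) M))))
      ≡⟨ cong₂ (λ u v → Σ N c + (ι N * u + (-1ℚ * v + (coeff (0ℚ ∷ P0) M + -1ℚ * Σ N (λ k → c k * coeff (Qk k) M)))))
           (trans (linProd-coeff-e₁ M (λ i → 1ℚ + a i)) (Σ-1+ N a)) (trans (linProd-shift-coeff-e₂ M (λ i → 1ℚ + a i)) (e₂-shift N a)) ⟩
    Σ N c + (ι N * (ι N + Σ N a) + (-1ℚ * (e₂ N a + (ι N - 1ℚ) * Σ N a + binom₂ N) + (coeff (0ℚ ∷ P0) M + -1ℚ * Σ N (λ k → c k * coeff (Qk k) M))))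
      ≡⟨ cong₂ (λ u v → Σ N c + (ι N * (ι N + Σ N a) + (-1ℚ * (e₂ N a + (ι N - 1ℚ) * Σ N a + binom₂ N) + (u + -1ℚ * v))))
           (linProd-shift-coeff-e₂ M a) ΣQ-top ⟩
    Σ N c + (ι N * (ι N + Σ N a) + (-1ℚ * (e₂ N a + (ι N - 1ℚ) * Σ N a + binom₂ N) + (e₂ N a + -1ℚ * Σ N c)))
      ≡⟨ solve 5 (λ C n s E D → C :+ (n :* (n :+ s) :+ (con -1ℚ :* (E :+ (n :- con 1ℚ) :* s :+ D) :+ (E :+ con -1ℚ :* C))) := n :* n :+ s :- D)
           refl (Σ N c) (ι N) (Σ N a) (e₂ N a) (binom₂ N) ⟩
    ι N * ι N + Σ N a - binom₂ N ∎
    where open ≡-Reasoning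

-- D = P1 − P0 − Σₖ cₖ Gₖ has degree < m (the hypothesis Σ c = n cancels the coefficient of z^m)
-- and vanishes at −a₁, …, −aₘ, hence is zero.
module DifferenceExpansion (m : ℕ) (a c : ℕ → ℚ) (dist : Distinct (suc m) a)
  (sumc : Σ (suc m) c ≡ ι (suc m))
  (node : ∀ k → 1 ≤ k → k ≤ m → Π (suc m) (λ i → 1ℚ + a i - a k) ≡ c k * (-1ℚ * Π∖ m k (λ i → a i - a k))) where
  n : ℕ
  n = suc m
  G : ℕ → Poly
  G k = linProd m (λ i → a i - δ k i)
  P1 P0 S T1 D : Poly
  P1 = linProd n (λ i → 1ℚ + a i)
  P0 = linProd n a
  S = ΣPoly n (λ k → c k ⊙ G k)
  T1 = (-1ℚ ⊙ P0) ⊕ (-1ℚ ⊙ S)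
  D = P1 ⊕ T1

  coeff-D : ∀ j → coeff D j ≡ coeff P1 j + (-1ℚ * coeff P0 j + -1ℚ * Σ n (λ k → c k * coeff (G k) j))
  coeff-D j = trans (⊕-coeff P1 T1 j) (cong (coeff P1 j +_) (trans (⊕-coeff (-1ℚ ⊙ P0) (-1ℚ ⊙ S) j)
    (cong₂ _+_ (⊙-coeff -1ℚ P0 j) (trans (⊙-coeff -1ℚ S j) (cong (-1ℚ *_) (trans (ΣPoly-coeff n (λ k → c k ⊙ G k) j)
      (Σ-cong n (λ k _ _ → ⊙-coeff (c k) (G k) j))))))))

  eval-D : ∀ z → eval D z ≡ eval P1 z + (-1ℚ * eval P0 z + -1ℚ * Σ n (λ k → c k * eval (G k) z))
  eval-D z = trans (⊕-eval P1 T1 z) (cong (eval P1 z +_) (trans (⊕-eval (-1ℚ ⊙ P0) (-1ℚ ⊙ S) z)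
    (cong₂ _+_ (⊙-eval -1ℚ P0 z) (trans (⊙-eval -1ℚ S z) (cong (-1ℚ *_) (trans (ΣPoly-eval n (λ k → c k ⊙ G k) z)
      (Σ-cong n (λ k _ _ → ⊙-eval (c k) (G k) z))))))))

  ΣG-above : ∀ j → m < j → Σ n (λ k → c k * coeff (G k) j) ≡ 0ℚ
  ΣG-above j m<j = Σ≡0 n _ (λ k _ _ → trans (cong (c k *_) (linProd-coeff-above m (λ i → a i - δ k i) j m<j)) (QP.*-zeroʳ (c k)))

  coeff-beyond : ∀ t → coeff D (m ℕ.+ t) ≡ 0ℚ
  coeff-beyond zero rewrite NP.+-identityʳ m = trans (coeff-D m)
    (trans (cong₂ (λ u v → u + (-1ℚ * v + -1ℚ * Σ n (λ k → c k * coeff (G k) m)))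
       (trans (linProd-coeff-e₁ m (λ i → 1ℚ + a i)) (Σ-1+ n a)) (linProd-coeff-e₁ m a))
    (trans (cong (λ u → ι n + Σ n a + (-1ℚ * Σ n a + -1ℚ * u))
       (trans (Σ-cong n (λ k _ _ → trans (cong (c k *_) (linProd-coeff-top m (λ i → a i - δ k i))) (QP.*-identityʳ (c k)))) sumc))
     (solve 2 (λ N s → N :+ s :+ (con -1ℚ :* s :+ con -1ℚ :* N) := con 0ℚ) refl (ι n) (Σ n a))))
  coeff-beyond (suc zero) rewrite NP.+-comm m 1 = trans (coeff-D n)
    (trans (cong₂ (λ u v → u + (-1ℚ * v + -1ℚ * Σ n (λ k → c k * coeff (G k) n)))
       (linProd-coeff-top n (λ i → 1ℚ + a i)) (linProd-coeff-top n a))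
    (trans (cong (λ u → 1ℚ + (-1ℚ * 1ℚ + -1ℚ * u)) (ΣG-above n (NP.n<1+n m)))
      (solve 0 (con 1ℚ :+ (con -1ℚ :* con 1ℚ :+ con -1ℚ :* con 0ℚ) := con 0ℚ) refl)))
  coeff-beyond (suc (suc t)) = trans (coeff-D (m ℕ.+ suc (suc t)))
    (trans (cong₂ (λ u v → u + (-1ℚ * v + -1ℚ * Σ n (λ k → c k * coeff (G k) (m ℕ.+ suc (suc t)))))
       (linProd-coeff-above n (λ i → 1ℚ + a i) (m ℕ.+ suc (suc t)) lt) (linProd-coeff-above n a (m ℕ.+ suc (suc t)) lt))
    (trans (cong (λ u → 0ℚ + (-1ℚ * 0ℚ + -1ℚ * u)) (ΣG-above (m ℕ.+ suc (suc t)) (NP.<-trans (NP.n<1+n m) lt)))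
      (solve 0 (con 0ℚ :+ (con -1ℚ :* con 0ℚ :+ con -1ℚ :* con 0ℚ) := con 0ℚ) refl)))
    where
    lt : n < m ℕ.+ suc (suc t)
    lt = NP.≤-trans (s≤s (s≤s (NP.m≤m+n m t))) (NP.≤-reflexive (sym (trans (NP.+-suc m (suc t)) (cong suc (NP.+-suc m t)))))

  deg : ∀ j → m ≤ j → coeff D j ≡ 0ℚ
  deg j m≤j = subst (λ j → coeff D j ≡ 0ℚ) (NP.m+[n∸m]≡n m≤j) (coeff-beyond (j ℕ.∸ m))

  roots : ∀ k → 1 ≤ k → k ≤ m → eval D (- a k) ≡ 0ℚ
  roots k h1 h2 = begin
    eval D z ≡⟨ eval-D z ⟩
    eval P1 z + (-1ℚ * eval P0 z + -1ℚ * Σ n (λ j → c j * eval (G j) z))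
      ≡⟨ cong₂ (λ u v → u + (-1ℚ * v + -1ℚ * Σ n (λ j → c j * eval (G j) z))) e1 e0 ⟩
    Π1 + (-1ℚ * 0ℚ + -1ℚ * Σ n (λ j → c j * eval (G j) z)) ≡⟨ cong (λ u → Π1 + (-1ℚ * 0ℚ + -1ℚ * u)) es ⟩
    Π1 + (-1ℚ * 0ℚ + -1ℚ * (c k * (-1ℚ * Πgaps⁺))) ≡⟨ cong (λ u → u + (-1ℚ * 0ℚ + -1ℚ * (c k * (-1ℚ * Πgaps⁺)))) (node k h1 h2) ⟩
    c k * (-1ℚ * Πgaps⁺) + (-1ℚ * 0ℚ + -1ℚ * (c k * (-1ℚ * Πgaps⁺)))
      ≡⟨ solve 2 (λ c x → c :* (con -1ℚ :* x) :+ (con -1ℚ :* con 0ℚ :+ con -1ℚ :* (c :* (con -1ℚ :* x))) := con 0ℚ) refl (c k) Πgaps⁺ ⟩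
    0ℚ ∎
    where
    open ≡-Reasoning
    z = - a k
    hn = NP.m≤n⇒m≤1+n h2
    Π1 = Π n (λ i → 1ℚ + a i - a k)
    Πgaps⁺ = Π∖ m k (λ i → a i - a k)
    e1 : eval P1 z ≡ Π1
    e1 = trans (linProd-eval n (λ i → 1ℚ + a i) z) (Π-cong n (λ i _ _ → solve 2 (λ ak ai → (:- ak) :+ (con 1ℚ :+ ai) := con 1ℚ :+ ai :- ak) refl (a k) (a i)))
    e0 : eval P0 z ≡ 0ℚ
    e0 = trans (linProd-eval n a z) (Π≡0 n k (λ i → z + a i) h1 hn (QP.+-inverseˡ (a k)))
    gk : eval (G k) z ≡ -1ℚ * Πgaps⁺
    gk = trans (linProd-eval m (λ i → a i - δ k i) z) (trans (Π≡f*Π∖ m k _ h1 h2)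
      (cong₂ _*_ (trans (cong (λ u → z + (a k - u)) (δ-refl k)) (solve 1 (λ ak → (:- ak) :+ (ak :- con 1ℚ) := con -1ℚ) refl (a k)))
        (Π∖-cong′ m k (λ i _ _ i≢k → trans (cong (λ u → z + (a i - u)) (δ-ne k i i≢k))
          (solve 2 (λ ak ai → (:- ak) :+ (ai :- con 0ℚ) := ai :- ak) refl (a k) (a i))))))
    es : Σ n (λ j → c j * eval (G j) z) ≡ c k * (-1ℚ * Πgaps⁺)
    es = trans (Σ-single n k (λ j → c j * eval (G j) z) h1 hn
           (λ j j≢k → trans (cong (c j *_) (trans (linProd-eval m (λ i → a i - δ j i) z)
              (Π≡0 m k (λ i → z + (a i - δ j i)) h1 h2
                 (trans (cong (λ u → z + (a k - u)) (δ-ne j k (λ e → j≢k (sym e))))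
                   (solve 1 (λ ak → (:- ak) :+ (ak :- con 0ℚ) := con 0ℚ) refl (a k)))))) (QP.*-zeroʳ (c j))))
         (cong (c k *_) gk)

  coeffs≡0 : ∀ j → coeff D j ≡ 0ℚ
  coeffs≡0 = roots⇒coeff≡0 m (λ k → - a k) D (Distinct-neg m a (Distinct-weaken m a dist)) roots deg

  Δ≡Σc : ∀ x → Π n (λ i → x + (1ℚ + a i)) - Π n (λ i → x + a i) ≡ Σ n (λ k → c k * Π m (λ i → x + (a i - δ k i)))
  Δ≡Σc x = begin
    A - B ≡⟨ solve 3 (λ A B C → A :- B := (A :+ (con -1ℚ :* B :+ con -1ℚ :* C)) :+ C) refl A B C ⟩
    (A + (-1ℚ * B + -1ℚ * C)) + C ≡⟨ cong (_+ C) zeroEq ⟩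
    0ℚ + C ≡⟨ QP.+-identityˡ C ⟩
    C ∎
    where
    open ≡-Reasoning
    A = Π n (λ i → x + (1ℚ + a i))
    B = Π n (λ i → x + a i)
    C = Σ n (λ k → c k * Π m (λ i → x + (a i - δ k i)))
    zeroEq : A + (-1ℚ * B + -1ℚ * C) ≡ 0ℚ
    zeroEq = trans (cong₂ (λ u v → u + v) (sym (linProd-eval n (λ i → 1ℚ + a i) x))
               (cong₂ (λ u v → -1ℚ * u + -1ℚ * v) (sym (linProd-eval n a x))
                 (sym (Σ-cong n (λ k _ _ → cong (c k *_) (linProd-eval m (λ i → a i - δ k i) x))))))
             (trans (sym (eval-D x)) (coeff≡0⇒eval≡0 D coeffs≡0 x))

-- Hook lengths

conj-cons-≤ : ∀ a ρ j → j ≤ a → conj (a ∷ ρ) j ≡ suc (conj ρ j)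
conj-cons-≤ a ρ j j≤a = cong length (LP.filter-accept (λ k → j ≤? k) j≤a)

conj-cons-> : ∀ a ρ j → a < j → conj (a ∷ ρ) j ≡ conj ρ j
conj-cons-> a ρ j a<j = cong length (LP.filter-reject (λ k → j ≤? k) (NP.<⇒≱ a<j))

conj-big : ∀ a ρ j → All (_≤ a) ρ → a < j → conj ρ j ≡ 0
conj-big a ρ j h a<j = cong length (LP.filter-none (λ k → j ≤? k)
  (All.map (λ {k} k≤a j≤k → NP.<⇒≱ a<j (NP.≤-trans j≤k k≤a)) h))

-- The product of the first-row hook lengths of a ∷ ρ, for ρ with all parts ≤ a.
hooks₁ : ℕ → List ℕ → ℚ
hooks₁ a ρ = Π a (λ j → ι (suc ((a ∸ j) ℕ.+ conj ρ j)))

hook-row₁ : ∀ a ρ j → All (_≤ a) ρ → hook (a ∷ ρ) 1 j ≡ suc ((a ∸ j) ℕ.+ conj ρ j)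
hook-row₁ a ρ j h = helper (j ≤? a)
  where
  helper : Dec (j ≤ a) → hook (a ∷ ρ) 1 j ≡ suc ((a ∸ j) ℕ.+ conj ρ j)
  helper (yes j≤a) = cong (λ t → suc ((a ∸ j) ℕ.+ (t ∸ 1))) (conj-cons-≤ a ρ j j≤a)
  helper (no j≰a) = trans (cong (λ t → suc ((a ∸ j) ℕ.+ (t ∸ 1))) (trans (conj-cons-> a ρ j (NP.≰⇒> j≰a)) z0))
                          (cong (λ t → suc ((a ∸ j) ℕ.+ t)) (sym z0))
    where z0 = conj-big a ρ j h (NP.≰⇒> j≰a)

hook-row-suc : ∀ a ρ x j → All (_≤ a) ρ → hook (a ∷ ρ) (suc (suc x)) j ≡ hook ρ (suc x) j
hook-row-suc a ρ x j h = helper (j ≤? a)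
  where
  helper : Dec (j ≤ a) → hook (a ∷ ρ) (suc (suc x)) j ≡ hook ρ (suc x) j
  helper (yes j≤a) = cong (λ t → suc ((part ρ (suc x) ∸ j) ℕ.+ (t ∸ suc (suc x)))) (conj-cons-≤ a ρ j j≤a)
  helper (no j≰a) = trans (cong (λ t → suc ((part ρ (suc x) ∸ j) ℕ.+ (t ∸ suc (suc x))))
                             (conj-cons-> a ρ j (NP.≰⇒> j≰a)))
                     (cong (λ t → suc ((part ρ (suc x) ∸ j) ℕ.+ t)) (trans (cong (_∸ suc (suc x)) z0) (sym (cong (_∸ suc x) z0))))
    where z0 = conj-big a ρ j h (NP.≰⇒> j≰a)

ιH-∷ : ∀ a ρ → All (_≤ a) ρ → ι (H (a ∷ ρ)) ≡ hooks₁ a ρ * ι (H ρ)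
ιH-∷ a ρ h = trans (cong ι (product-++ (map (hook (a ∷ ρ) 1) (range1 a)) rest))
  (trans (ι-* (product (map (hook (a ∷ ρ) 1) (range1 a))) (product rest))
  (cong₂ _*_ (trans (ι-product-range1 a (hook (a ∷ ρ) 1)) (Π-cong a (λ j _ _ → cong ι (hook-row₁ a ρ j h))))
             (cong (ι ∘ product) rest≡)))
  where
  ℓ = length ρ
  F : ℕ → List ℕ
  F i = map (hook (a ∷ ρ) i) (range1 (part (a ∷ ρ) i))
  F' : ℕ → List ℕ
  F' i = map (hook ρ i) (range1 (part ρ i))
  rest = concatMap F (map suc (applyUpTo suc ℓ))
  rest≡ : rest ≡ concatMap F' (range1 ℓ)
  rest≡ = cong concat (begin
    map F (map suc (applyUpTo suc ℓ)) ≡⟨ cong (map F) (LP.map-applyUpTo suc suc ℓ) ⟩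
    map F (applyUpTo (suc ∘ suc) ℓ) ≡⟨ LP.map-applyUpTo (suc ∘ suc) F ℓ ⟩
    applyUpTo (F ∘ suc ∘ suc) ℓ ≡⟨ applyUpTo-cong ℓ _ _ (λ x → LP.map-cong (λ j → hook-row-suc a ρ x j h) (range1 (part ρ (suc x)))) ⟩
    applyUpTo (F' ∘ suc) ℓ ≡⟨ sym (LP.map-applyUpTo suc F' ℓ) ⟩
    map F' (applyUpTo suc ℓ) ≡⟨ cong (map F') (sym (LP.map-upTo suc ℓ)) ⟩
    map F' (range1 ℓ) ∎)
    where open ≡-Reasoning

product-pos : ∀ l → All (0 <_) l → 0 < product l
product-pos [] _ = s≤s z≤n
product-pos (suc x ∷ l) (_ ∷ h) with product l | product-pos l h
... | suc y | _ = s≤s z≤n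

H-pos : ∀ la → 0 < H la
H-pos la = product-pos (concatMap F (range1 (length la)))
  (AllP.concat⁺ (AllP.map⁺ {f = F} (All.universal (λ i → AllP.map⁺ {f = hook la i} (All.universal {P = λ j → 0 < hook la i j} (λ j → s≤s z≤n) (range1 (part la i)))) (range1 (length la)))))
  where F = λ i → map (hook la i) (range1 (part la i))

ιH*invℕH : ∀ la → ι (H la) * invℕ (H la) ≡ 1ℚ
ιH*invℕH la with H la | H-pos la
... | suc h | _ = ι*invℕ h

Decreasing : List ℕ → Set
Decreasing = Linked (λ a b → b ≤ a)

Decreasing-tail : ∀ {a ρ} → Decreasing (a ∷ ρ) → Decreasing ρ
Decreasing-tail [-] = []
Decreasing-tail (_ ∷ l) = l

Decreasing-head : ∀ {a ρ} → Decreasing (a ∷ ρ) → All (_≤ a) ρ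
Decreasing-head [-] = []
Decreasing-head {a} (b≤a ∷ l) = b≤a ∷ All.map (λ x≤b → NP.≤-trans x≤b b≤a) (Decreasing-head l)

Decreasing-∷ : ∀ {a ρ} → All (_≤ a) ρ → Decreasing ρ → Decreasing (a ∷ ρ)
Decreasing-∷ [] [] = [-]
Decreasing-∷ (b≤a ∷ _) l = b≤a ∷ l

part-le : ∀ a ρ i → All (_≤ a) ρ → part ρ i ≤ a
part-le a [] i h = z≤n
part-le a (r ∷ ρ) zero h = z≤n
part-le a (r ∷ ρ) (suc zero) (r≤a ∷ h) = r≤a
part-le a (r ∷ ρ) (suc (suc i)) (_ ∷ h) = part-le a ρ (suc i) h

part-zero : ∀ la i → length la < i → part la i ≡ 0
part-zero [] i _ = refl
part-zero (a ∷ la) (suc (suc i)) (s≤s lt) = part-zero la (suc i) lt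

part-pos : ∀ la i → All (0 <_) la → 1 ≤ i → i ≤ length la → 0 < part la i
part-pos (a ∷ la) (suc zero) (p ∷ _) _ _ = p
part-pos (a ∷ la) (suc (suc i)) (_ ∷ ps) _ (s≤s le) = part-pos la (suc i) ps (s≤s z≤n) le

part-mono : ∀ la i j → Decreasing la → 1 ≤ i → i ≤ j → part la j ≤ part la i
part-mono [] i j l _ _ = z≤n
part-mono (a ∷ ρ) (suc zero) (suc zero) l _ _ = NP.≤-refl
part-mono (a ∷ ρ) (suc zero) (suc (suc j)) l _ _ = part-le a ρ (suc j) (Decreasing-head l)
part-mono (a ∷ ρ) (suc (suc i)) (suc (suc j)) l _ (s≤s le) = part-mono ρ (suc i) (suc j) (Decreasing-tail l) (s≤s z≤n) le

len≤size : ∀ la → All (0 <_) la → length la ≤ size la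
len≤size [] _ = z≤n
len≤size (a ∷ la) (p ∷ ps) = NP.+-mono-≤ p (len≤size la ps)

Σpart≡size : ∀ la N → length la ≤ N → Σ N (λ i → ι (part la i)) ≡ ι (size la)
Σpart≡size [] N _ = Σ-0 N
Σpart≡size (a ∷ la) (suc N) (s≤s le) = trans (cong (ι a +_) (trans (Σ-cong N (λ { (suc i) _ _ → refl })) (Σpart≡size la N le))) (sym (ι-+ a (size la)))

length≡size⇒All≤1 : ∀ la → All (0 <_) la → length la ≡ size la → All (_≤ 1) la
length≡size⇒All≤1 [] _ _ = []
length≡size⇒All≤1 (a ∷ la) (p ∷ ps) e = a≤1 ∷ length≡size⇒All≤1 la ps (NP.suc-injective (trans e (cong (ℕ._+ size la) a≡1)))
  where
  a≤1 : a ≤ 1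
  a≤1 = NP.+-cancelʳ-≤ (size la) a 1 (NP.≤-trans (NP.≤-reflexive (sym e)) (s≤s (len≤size la ps)))
  a≡1 : a ≡ 1
  a≡1 = NP.≤-antisym a≤1 p

shifted : List ℕ → ℕ → ℚ
shifted la i = ι (part la i) - ι i

g≡Π : ∀ la y → g la y ≡ Π (size la) (λ i → y + shifted la i)
g≡Π la y = trans (prodℚ-range1 (size la) _) (Π-cong (size la) (λ i _ _ → solve 3 (λ y P I → y :+ P :- I := y :+ (P :- I)) refl y (ι (part la i)) (ι i)))

shifted-injective : ∀ la → Decreasing la → ∀ i j → 1 ≤ i → i ≤ j → i < j → shifted la j ≡ shifted la i → ⊥
shifted-injective la l i j h i≤j i<j e = NP.<⇒≢ lt (ι-injective (trans (ι-+ (part la j) i) (trans eq (sym (ι-+ (part la i) j)))))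
  where
  eq : ι (part la j) + ι i ≡ ι (part la i) + ι j
  eq = trans (solve 3 (λ P I J → P :+ I := (P :- J) :+ I :+ J) refl (ι (part la j)) (ι i) (ι j))
        (trans (cong (λ t → t + ι i + ι j) e) (solve 3 (λ P I J → (P :- I) :+ I :+ J := P :+ J) refl (ι (part la i)) (ι i) (ι j)))
  lt : part la j ℕ.+ i < part la i ℕ.+ j
  lt = NP.+-mono-≤-< (part-mono la i j l h i≤j) i<j

shifted-distinct : ∀ la N → Decreasing la → Distinct N (shifted la)
shifted-distinct la N l i j h1 h2 h3 h4 ne e with NP.<-cmp i j
... | tri< i<j _ _ = shifted-injective la l i j h1 (NP.<⇒≤ i<j) i<j (sym e)
... | tri≈ _ i≡j _ = ne i≡j
... | tri> _ _ j<i = shifted-injective la l j i h3 (NP.<⇒≤ j<i) j<i e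

conj-1 : ∀ ρ → All (0 <_) ρ → conj ρ 1 ≡ length ρ
conj-1 ρ h = cong length (LP.filter-all (λ k → 1 ≤? k) h)

dropColumn₁ : List ℕ → List ℕ
dropColumn₁ [] = []
dropColumn₁ (zero ∷ ρ) = dropColumn₁ ρ
dropColumn₁ (suc zero ∷ ρ) = dropColumn₁ ρ
dropColumn₁ (suc (suc r) ∷ ρ) = suc r ∷ dropColumn₁ ρ

conj-dropColumn₁ : ∀ ρ x → conj (dropColumn₁ ρ) (suc x) ≡ conj ρ (suc (suc x))
conj-dropColumn₁ [] x = refl
conj-dropColumn₁ (zero ∷ ρ) x = trans (conj-dropColumn₁ ρ x) (sym (cong length (LP.filter-reject (λ k → suc (suc x) ≤? k) {0} {ρ} (λ ()))))
conj-dropColumn₁ (suc zero ∷ ρ) x = trans (conj-dropColumn₁ ρ x) (sym (cong length (LP.filter-reject (λ k → suc (suc x) ≤? k) {1} {ρ} (λ { (s≤s ()) }))))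
conj-dropColumn₁ (suc (suc r) ∷ ρ) x with suc x ≤? suc r
... | yes le = trans (cong length (LP.filter-accept (λ k → suc x ≤? k) {suc r} {dropColumn₁ ρ} le))
     (trans (cong suc (conj-dropColumn₁ ρ x)) (sym (cong length (LP.filter-accept (λ k → suc (suc x) ≤? k) {suc (suc r)} {ρ} (s≤s le)))))
... | no nle = trans (cong length (LP.filter-reject (λ k → suc x ≤? k) {suc r} {dropColumn₁ ρ} nle))
     (trans (conj-dropColumn₁ ρ x) (sym (cong length (LP.filter-reject (λ k → suc (suc x) ≤? k) {suc (suc r)} {ρ} (λ { (s≤s le) → nle le })))))

dropColumn₁-bound : ∀ s ρ → All (_≤ suc s) ρ → All (_≤ s) (dropColumn₁ ρ)
dropColumn₁-bound s [] h = []
dropColumn₁-bound s (zero ∷ ρ) (_ ∷ h) = dropColumn₁-bound s ρ h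
dropColumn₁-bound s (suc zero ∷ ρ) (_ ∷ h) = dropColumn₁-bound s ρ h
dropColumn₁-bound s (suc (suc r) ∷ ρ) (s≤s le ∷ h) = le ∷ dropColumn₁-bound s ρ h

dropColumn₁-pos : ∀ ρ → All (0 <_) (dropColumn₁ ρ)
dropColumn₁-pos [] = []
dropColumn₁-pos (zero ∷ ρ) = dropColumn₁-pos ρ
dropColumn₁-pos (suc zero ∷ ρ) = dropColumn₁-pos ρ
dropColumn₁-pos (suc (suc r) ∷ ρ) = s≤s z≤n ∷ dropColumn₁-pos ρ

dropColumn₁-decreasing : ∀ ρ → Decreasing ρ → Decreasing (dropColumn₁ ρ)
dropColumn₁-decreasing [] l = []
dropColumn₁-decreasing (zero ∷ ρ) l = dropColumn₁-decreasing ρ (Decreasing-tail l)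
dropColumn₁-decreasing (suc zero ∷ ρ) l = dropColumn₁-decreasing ρ (Decreasing-tail l)
dropColumn₁-decreasing (suc (suc r) ∷ ρ) l = Decreasing-∷ (dropColumn₁-bound (suc r) ρ (Decreasing-head l)) (dropColumn₁-decreasing ρ (Decreasing-tail l))

dropColumn₁-length : ∀ ρ → length (dropColumn₁ ρ) ≤ length ρ
dropColumn₁-length [] = z≤n
dropColumn₁-length (zero ∷ ρ) = NP.m≤n⇒m≤1+n (dropColumn₁-length ρ)
dropColumn₁-length (suc zero ∷ ρ) = NP.m≤n⇒m≤1+n (dropColumn₁-length ρ)
dropColumn₁-length (suc (suc r) ∷ ρ) = s≤s (dropColumn₁-length ρ)

dropColumn₁-ones : ∀ ρ → All (_≤ 1) ρ → dropColumn₁ ρ ≡ []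
dropColumn₁-ones [] h = refl
dropColumn₁-ones (zero ∷ ρ) (_ ∷ h) = dropColumn₁-ones ρ h
dropColumn₁-ones (suc zero ∷ ρ) (_ ∷ h) = dropColumn₁-ones ρ h
dropColumn₁-ones (suc (suc r) ∷ ρ) (s≤s () ∷ h)

part-ones : ∀ ρ i → All (_≤ 1) ρ → All (0 <_) ρ → 1 ≤ i → i ≤ length ρ → part ρ i ≡ 1
part-ones (r ∷ ρ) (suc zero) (r≤1 ∷ _) (0<r ∷ _) _ _ = NP.≤-antisym r≤1 0<r
part-ones (r ∷ ρ) (suc (suc i)) (_ ∷ h) (_ ∷ p) _ (s≤s le) = part-ones ρ (suc i) h p (s≤s z≤n) le

part-dropColumn₁ : ∀ ρ i → Decreasing ρ → All (0 <_) ρ → 1 ≤ i → i ≤ length ρ → part ρ i ≡ suc (part (dropColumn₁ ρ) i)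
part-dropColumn₁ [] (suc i) l p h1 ()
part-dropColumn₁ (zero ∷ ρ) i l (() ∷ p) h1 h2
part-dropColumn₁ (suc zero ∷ ρ) i l p h1 h2 =
  trans (part-ones (1 ∷ ρ) i (s≤s z≤n ∷ Decreasing-head l) p h1 h2)
    (cong (λ t → suc (part t i)) (sym (dropColumn₁-ones ρ (Decreasing-head l))))
part-dropColumn₁ (suc (suc r) ∷ ρ) (suc zero) l p _ _ = refl
part-dropColumn₁ (suc (suc r) ∷ ρ) (suc (suc i)) l (_ ∷ p) _ (s≤s le) = part-dropColumn₁ ρ (suc i) (Decreasing-tail l) p (s≤s z≤n) le

Πgaps⁺ : ℕ → List ℕ → ℕ → ℚ
Πgaps⁺ s ρ L = Π L (λ i → ι (part ρ i) - ι i - 1ℚ - ι s)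

Πgaps : ℕ → List ℕ → ℕ → ℚ
Πgaps s ρ L = Π L (λ i → ι (part ρ i) - ι i - ι s)

telescope : ∀ t d u → Π t (λ i → 0ℚ - ι (d ℕ.+ i) - 1ℚ - u) * (ι (suc d) + u) ≡ (ι (suc (d ℕ.+ t)) + u) * Π t (λ i → 0ℚ - ι (d ℕ.+ i) - u)
telescope zero d u rewrite NP.+-identityʳ d = trans (QP.*-identityˡ (ι (suc d) + u)) (sym (QP.*-identityʳ (ι (suc d) + u)))
telescope (suc t) d u = begin
  (0ℚ - ι (d ℕ.+ 1) - 1ℚ - u) * Π t (λ i → 0ℚ - ι (d ℕ.+ suc i) - 1ℚ - u) * (ι (suc d) + u)
    ≡⟨ cong₂ (λ v w → (0ℚ - v - 1ℚ - u) * w * (ι (suc d) + u)) e1 eP ⟩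
  (0ℚ - (ι d + 1ℚ) - 1ℚ - u) * P * (ι (suc d) + u)
    ≡⟨ cong (λ v → (0ℚ - (ι d + 1ℚ) - 1ℚ - u) * P * (v + u)) (ι-suc d) ⟩
  (0ℚ - (ι d + 1ℚ) - 1ℚ - u) * P * (ι d + 1ℚ + u)
    ≡⟨ solve 3 (λ D u P → (con 0ℚ :- (D :+ con 1ℚ) :- con 1ℚ :- u) :* P :* (D :+ con 1ℚ :+ u) :=
          (con 0ℚ :- (D :+ con 1ℚ :+ u)) :* (P :* (D :+ con 1ℚ :+ con 1ℚ :+ u))) refl (ι d) u P ⟩
  (0ℚ - (ι d + 1ℚ + u)) * (P * (ι d + 1ℚ + 1ℚ + u))
    ≡⟨ cong (λ v → (0ℚ - (ι d + 1ℚ + u)) * (P * (v + u))) (sym (trans (ι-suc (suc d)) (cong (_+ 1ℚ) (ι-suc d)))) ⟩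
  (0ℚ - (ι d + 1ℚ + u)) * (P * (ι (suc (suc d)) + u)) ≡⟨ cong ((0ℚ - (ι d + 1ℚ + u)) *_) (telescope t (suc d) u) ⟩
  (0ℚ - (ι d + 1ℚ + u)) * ((ι (suc (suc d ℕ.+ t)) + u) * Qt)
    ≡⟨ solve 4 (λ D u W Q → (con 0ℚ :- (D :+ con 1ℚ :+ u)) :* (W :* Q) := W :* ((con 0ℚ :- (D :+ con 1ℚ) :- u) :* Q)) refl (ι d) u (ι (suc (suc d ℕ.+ t)) + u) Qt ⟩
  (ι (suc (suc d ℕ.+ t)) + u) * ((0ℚ - (ι d + 1ℚ) - u) * Qt)
    ≡⟨ cong₂ (λ v w → (ι v + u) * ((0ℚ - w - u) * Qt)) (cong suc (sym (NP.+-suc d t))) (sym e1) ⟩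
  (ι (suc (d ℕ.+ suc t)) + u) * ((0ℚ - ι (d ℕ.+ 1) - u) * Qt)
    ≡⟨ cong (λ w → (ι (suc (d ℕ.+ suc t)) + u) * ((0ℚ - ι (d ℕ.+ 1) - u) * w)) (sym eQ) ⟩
  (ι (suc (d ℕ.+ suc t)) + u) * ((0ℚ - ι (d ℕ.+ 1) - u) * Π t (λ i → 0ℚ - ι (d ℕ.+ suc i) - u)) ∎
  where
  open ≡-Reasoning
  P = Π t (λ i → 0ℚ - ι (suc d ℕ.+ i) - 1ℚ - u)
  Qt = Π t (λ i → 0ℚ - ι (suc d ℕ.+ i) - u)
  e1 : ι (d ℕ.+ 1) ≡ ι d + 1ℚ
  e1 = ι-+ d 1
  eP : Π t (λ i → 0ℚ - ι (d ℕ.+ suc i) - 1ℚ - u) ≡ P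
  eP = Π-cong t (λ i _ _ → cong (λ v → 0ℚ - ι v - 1ℚ - u) (NP.+-suc d i))
  eQ : Π t (λ i → 0ℚ - ι (d ℕ.+ suc i) - u) ≡ Qt
  eQ = Π-cong t (λ i _ _ → cong (λ v → 0ℚ - ι v - u) (NP.+-suc d i))

hooks₁-suc-extend : ∀ s ρ t → hooks₁ (suc s) ρ * Πgaps⁺ s ρ (length ρ) ≡ hooks₁ s ρ * (ι (suc (length ρ)) + ι s) * Πgaps s ρ (length ρ) →
  hooks₁ (suc s) ρ * Πgaps⁺ s ρ (length ρ ℕ.+ t) ≡ hooks₁ s ρ * (ι (suc (length ρ ℕ.+ t)) + ι s) * Πgaps s ρ (length ρ ℕ.+ t)
hooks₁-suc-extend s ρ t base = begin
  hooks₁ (suc s) ρ * Πgaps⁺ s ρ (d ℕ.+ t) ≡⟨ cong (hooks₁ (suc s) ρ *_) (trans (Π-split d t _) (cong (Πgaps⁺ s ρ d *_) tX)) ⟩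
  hooks₁ (suc s) ρ * (Πgaps⁺ s ρ d * T1) ≡⟨ sym (QP.*-assoc (hooks₁ (suc s) ρ) (Πgaps⁺ s ρ d) T1) ⟩
  hooks₁ (suc s) ρ * Πgaps⁺ s ρ d * T1 ≡⟨ cong (_* T1) base ⟩
  hooks₁ s ρ * (ι (suc d) + ι s) * Πgaps s ρ d * T1
    ≡⟨ solve 5 (λ R A B C D → R :* A :* B :* C := R :* B :* (C :* A)) refl (hooks₁ s ρ) (ι (suc d) + ι s) (Πgaps s ρ d) T1 T0 ⟩
  hooks₁ s ρ * Πgaps s ρ d * (T1 * (ι (suc d) + ι s)) ≡⟨ cong (hooks₁ s ρ * Πgaps s ρ d *_) (telescope t d (ι s)) ⟩
  hooks₁ s ρ * Πgaps s ρ d * ((ι (suc (d ℕ.+ t)) + ι s) * T0)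
    ≡⟨ solve 4 (λ R B W C → R :* B :* (W :* C) := R :* W :* (B :* C)) refl (hooks₁ s ρ) (Πgaps s ρ d) (ι (suc (d ℕ.+ t)) + ι s) T0 ⟩
  hooks₁ s ρ * (ι (suc (d ℕ.+ t)) + ι s) * (Πgaps s ρ d * T0)
    ≡⟨ cong (hooks₁ s ρ * (ι (suc (d ℕ.+ t)) + ι s) *_) (sym (trans (Π-split d t _) (cong (Πgaps s ρ d *_) tY))) ⟩
  hooks₁ s ρ * (ι (suc (d ℕ.+ t)) + ι s) * Πgaps s ρ (d ℕ.+ t) ∎
  where
  open ≡-Reasoning
  d = length ρ
  T1 = Π t (λ i → 0ℚ - ι (d ℕ.+ i) - 1ℚ - ι s)
  T0 = Π t (λ i → 0ℚ - ι (d ℕ.+ i) - ι s)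
  pz : ∀ i → 1 ≤ i → ι (part ρ (d ℕ.+ i)) ≡ 0ℚ
  pz i 1≤i = cong ι (part-zero ρ (d ℕ.+ i) (NP.m<m+n d 1≤i))
  tX : Π t (λ i → ι (part ρ (d ℕ.+ i)) - ι (d ℕ.+ i) - 1ℚ - ι s) ≡ T1
  tX = Π-cong t (λ i h1 _ → cong (λ v → v - ι (d ℕ.+ i) - 1ℚ - ι s) (pz i h1))
  tY : Π t (λ i → ι (part ρ (d ℕ.+ i)) - ι (d ℕ.+ i) - ι s) ≡ T0
  tY = Π-cong t (λ i h1 _ → cong (λ v → v - ι (d ℕ.+ i) - ι s) (pz i h1))

hooks₁-dropColumn₁ : ∀ s ρ → All (0 <_) ρ → hooks₁ (suc s) ρ ≡ ι (suc (s ℕ.+ length ρ)) * hooks₁ s (dropColumn₁ ρ)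
hooks₁-dropColumn₁ s ρ p = cong₂ _*_ (cong (λ v → ι (suc (s ℕ.+ v))) (conj-1 ρ p))
  (Π-cong s (λ { (suc j) _ _ → cong (λ v → ι (suc ((s ∸ suc j) ℕ.+ v))) (sym (conj-dropColumn₁ ρ j)) }))

-- The hook-ratio identity for the last box of the first row of (s + 1) ∷ ρ: removing the first
-- column of ρ lowers s by one, and rows beyond the length of ρ only contribute telescoping factors.
mutual
  hooks₁-suc-at-length : ∀ s ρ → Decreasing ρ → All (0 <_) ρ → All (_≤ s) ρ →
    hooks₁ (suc s) ρ * Πgaps⁺ s ρ (length ρ) ≡ hooks₁ s ρ * (ι (suc (length ρ)) + ι s) * Πgaps s ρ (length ρ)
  hooks₁-suc-at-length zero [] l p b = refl
  hooks₁-suc-at-length zero (r ∷ ρ) l (0<r ∷ _) (r≤0 ∷ _) = ⊥-elim (NP.<⇒≱ 0<r r≤0)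
  hooks₁-suc-at-length (suc s) ρ l p b = begin
    hooks₁ (suc (suc s)) ρ * Πgaps⁺ (suc s) ρ d ≡⟨ cong₂ _*_ (hooks₁-dropColumn₁ (suc s) ρ p) eX ⟩
    ι (suc (suc s ℕ.+ d)) * hooks₁ (suc s) ρ⁻ * Πgaps⁺ s ρ⁻ d ≡⟨ QP.*-assoc (ι (suc (suc s ℕ.+ d))) (hooks₁ (suc s) ρ⁻) (Πgaps⁺ s ρ⁻ d) ⟩
    ι (suc (suc s ℕ.+ d)) * (hooks₁ (suc s) ρ⁻ * Πgaps⁺ s ρ⁻ d) ≡⟨ cong (ι (suc (suc s ℕ.+ d)) *_) IH ⟩
    ι (suc (suc s ℕ.+ d)) * (hooks₁ s ρ⁻ * (ι (suc d) + ι s) * Πgaps s ρ⁻ d)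
      ≡⟨ cong₂ (λ u v → u * (hooks₁ s ρ⁻ * (v + ι s) * Πgaps s ρ⁻ d)) (trans (ι-suc-+ (suc s) d) (cong (λ w → w + ι d + 1ℚ) (ι-suc s))) (ι-suc d) ⟩
    (ι s + 1ℚ + ι d + 1ℚ) * (hooks₁ s ρ⁻ * (ι d + 1ℚ + ι s) * Πgaps s ρ⁻ d)
      ≡⟨ solve 4 (λ S D R Yv → (S :+ con 1ℚ :+ D :+ con 1ℚ) :* (R :* (D :+ con 1ℚ :+ S) :* Yv) :=
            (S :+ D :+ con 1ℚ) :* R :* (D :+ con 1ℚ :+ (S :+ con 1ℚ)) :* Yv) refl (ι s) (ι d) (hooks₁ s ρ⁻) (Πgaps s ρ⁻ d) ⟩
    (ι s + ι d + 1ℚ) * hooks₁ s ρ⁻ * (ι d + 1ℚ + (ι s + 1ℚ)) * Πgaps s ρ⁻ d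
      ≡⟨ cong₂ (λ u v → u * hooks₁ s ρ⁻ * v * Πgaps s ρ⁻ d) (sym (ι-suc-+ s d)) (cong₂ _+_ (sym (ι-suc d)) (sym (ι-suc s))) ⟩
    ι (suc (s ℕ.+ d)) * hooks₁ s ρ⁻ * (ι (suc d) + ι (suc s)) * Πgaps s ρ⁻ d
      ≡⟨ cong₂ (λ u v → u * (ι (suc d) + ι (suc s)) * v) (sym (hooks₁-dropColumn₁ s ρ p)) (sym eY) ⟩
    hooks₁ (suc s) ρ * (ι (suc d) + ι (suc s)) * Πgaps (suc s) ρ d ∎
    where
    open ≡-Reasoning
    d = length ρ
    ρ⁻ = dropColumn₁ ρ
    IH = hooks₁-suc s ρ⁻ d (dropColumn₁-decreasing ρ l) (dropColumn₁-pos ρ) (dropColumn₁-bound s ρ b) (dropColumn₁-length ρ)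
    eX : Πgaps⁺ (suc s) ρ d ≡ Πgaps⁺ s ρ⁻ d
    eX = Π-cong d (λ i h1 h2 → trans (cong (λ v → ι v - ι i - 1ℚ - ι (suc s)) (part-dropColumn₁ ρ i l p h1 h2))
      (trans (cong₂ (λ v w → v - ι i - 1ℚ - w) (ι-suc (part ρ⁻ i)) (ι-suc s))
        (solve 3 (λ P I S → P :+ con 1ℚ :- I :- con 1ℚ :- (S :+ con 1ℚ) := P :- I :- con 1ℚ :- S) refl (ι (part ρ⁻ i)) (ι i) (ι s))))
    eY : Πgaps (suc s) ρ d ≡ Πgaps s ρ⁻ d
    eY = Π-cong d (λ i h1 h2 → trans (cong (λ v → ι v - ι i - ι (suc s)) (part-dropColumn₁ ρ i l p h1 h2))
      (trans (cong₂ (λ v w → v - ι i - w) (ι-suc (part ρ⁻ i)) (ι-suc s))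
        (solve 3 (λ P I S → P :+ con 1ℚ :- I :- (S :+ con 1ℚ) := P :- I :- S) refl (ι (part ρ⁻ i)) (ι i) (ι s))))

  hooks₁-suc : ∀ s ρ L → Decreasing ρ → All (0 <_) ρ → All (_≤ s) ρ → length ρ ≤ L →
    hooks₁ (suc s) ρ * Πgaps⁺ s ρ L ≡ hooks₁ s ρ * (ι (suc L) + ι s) * Πgaps s ρ L
  hooks₁-suc s ρ L l p b le = subst (λ L → hooks₁ (suc s) ρ * Πgaps⁺ s ρ L ≡ hooks₁ s ρ * (ι (suc L) + ι s) * Πgaps s ρ L)
    (NP.m+[n∸m]≡n le) (hooks₁-suc-extend s ρ (L ∸ length ρ) (hooks₁-suc-at-length s ρ l p b))

-- Removing a corner

pos? : (k : ℕ) → Dec (0 < k)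
pos? k = 0 <? k

conj-filter-pos : ∀ l j → 1 ≤ j → conj (filter pos? l) j ≡ conj l j
conj-filter-pos [] j _ = refl
conj-filter-pos (zero ∷ l) (suc j) h = trans (conj-filter-pos l (suc j) h)
  (sym (cong length (LP.filter-reject (λ k → suc j ≤? k) {0} {l} (λ ()))))
conj-filter-pos (suc x ∷ l) (suc j) h with suc j ≤? suc x
... | yes le = trans (cong length (LP.filter-accept (λ k → suc j ≤? k) {suc x} {filter pos? l} le))
     (trans (cong suc (conj-filter-pos l (suc j) h)) (sym (cong length (LP.filter-accept (λ k → suc j ≤? k) {suc x} {l} le))))
... | no nle = trans (cong length (LP.filter-reject (λ k → suc j ≤? k) {suc x} {filter pos? l} nle))
     (trans (conj-filter-pos l (suc j) h) (sym (cong length (LP.filter-reject (λ k → suc j ≤? k) {suc x} {l} nle))))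

conj-decRow-ne : ∀ ρ k j → j ≢ part ρ k → conj (decRow ρ k) j ≡ conj ρ j
conj-decRow-ne [] k j ne = refl
conj-decRow-ne (r ∷ ρ) zero j ne = refl
conj-decRow-ne (r ∷ ρ) (suc zero) j ne with j ≤? r
... | yes j≤r = trans (cong length (LP.filter-accept (λ k → j ≤? k) {r ∸ 1} {ρ} j≤r-1))
     (sym (cong length (LP.filter-accept (λ k → j ≤? k) {r} {ρ} j≤r)))
  where j≤r-1 : j ≤ r ∸ 1
        j≤r-1 = NP.<⇒≤pred (NP.≤∧≢⇒< j≤r ne)
... | no j≰r = trans (cong length (LP.filter-reject (λ k → j ≤? k) {r ∸ 1} {ρ} (λ le → j≰r (NP.≤-trans le (NP.m∸n≤m r 1)))))
     (sym (cong length (LP.filter-reject (λ k → j ≤? k) {r} {ρ} j≰r)))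
conj-decRow-ne (r ∷ ρ) (suc (suc k)) j ne with j ≤? r
... | yes j≤r = trans (cong length (LP.filter-accept (λ k → j ≤? k) {r} {decRow ρ (suc k)} j≤r))
     (trans (cong suc (conj-decRow-ne ρ (suc k) j ne)) (sym (cong length (LP.filter-accept (λ k → j ≤? k) {r} {ρ} j≤r))))
... | no j≰r = trans (cong length (LP.filter-reject (λ k → j ≤? k) {r} {decRow ρ (suc k)} j≰r))
     (trans (conj-decRow-ne ρ (suc k) j ne) (sym (cong length (LP.filter-reject (λ k → j ≤? k) {r} {ρ} j≰r))))

conj-decRow-eq : ∀ ρ k j → j ≡ part ρ k → 1 ≤ j → conj ρ j ≡ suc (conj (decRow ρ k) j)
conj-decRow-eq [] k .0 refl ()
conj-decRow-eq (r ∷ ρ) zero .0 refl ()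
conj-decRow-eq (r ∷ ρ) (suc zero) .r refl 1≤r =
  trans (cong length (LP.filter-accept (λ k → r ≤? k) {r} {ρ} NP.≤-refl))
    (cong suc (sym (cong length (LP.filter-reject (λ k → r ≤? k) {r ∸ 1} {ρ} (λ le → NP.<⇒≱ (NP.∸-monoʳ-< (s≤s z≤n) 1≤r) le)))))
conj-decRow-eq (r ∷ ρ) (suc (suc k)) j e 1≤j with j ≤? r
... | yes j≤r = trans (cong length (LP.filter-accept (λ k → j ≤? k) {r} {ρ} j≤r))
     (trans (cong suc (conj-decRow-eq ρ (suc k) j e 1≤j)) (cong suc (sym (cong length (LP.filter-accept (λ k → j ≤? k) {r} {decRow ρ (suc k)} j≤r)))))
... | no j≰r = trans (cong length (LP.filter-reject (λ k → j ≤? k) {r} {ρ} j≰r))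
     (trans (conj-decRow-eq ρ (suc k) j e 1≤j) (cong suc (sym (cong length (LP.filter-reject (λ k → j ≤? k) {r} {decRow ρ (suc k)} j≰r)))))

conj-corner : ∀ ρ k → Decreasing ρ → 1 ≤ k → part ρ (suc k) < part ρ k → conj ρ (part ρ k) ≡ k
conj-corner (r ∷ ρ) (suc zero) l _ lt =
  trans (cong length (LP.filter-accept (λ k → r ≤? k) {r} {ρ} NP.≤-refl))
    (cong suc (conj-big (part ρ 1) ρ r (hd ρ (Decreasing-tail l)) lt))
  where
  hd : ∀ ρ → Decreasing ρ → All (_≤ part ρ 1) ρ
  hd [] _ = []
  hd (x ∷ ρ) l = NP.≤-refl ∷ Decreasing-head l
conj-corner (r ∷ ρ) (suc (suc k)) l _ lt =
  trans (cong length (LP.filter-accept (λ t → part ρ (suc k) ≤? t) {r} {ρ} (part-le r ρ (suc k) (Decreasing-head l))))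
    (cong suc (conj-corner ρ (suc k) (Decreasing-tail l) (s≤s z≤n) lt))

decRow-All≤ : ∀ a ρ k → All (_≤ a) ρ → All (_≤ a) (decRow ρ k)
decRow-All≤ a [] k h = []
decRow-All≤ a (r ∷ ρ) zero h = h
decRow-All≤ a (r ∷ ρ) (suc zero) (r≤a ∷ h) = NP.≤-trans (NP.m∸n≤m r 1) r≤a ∷ h
decRow-All≤ a (r ∷ ρ) (suc (suc k)) (r≤a ∷ h) = r≤a ∷ decRow-All≤ a ρ (suc k) h

Decreasing⇒All≤ : ∀ s ρ → Decreasing ρ → part ρ 1 ≤ s → All (_≤ s) ρ
Decreasing⇒All≤ s [] _ _ = []
Decreasing⇒All≤ s (r ∷ ρ) l r≤s = r≤s ∷ All.map (λ x≤r → NP.≤-trans x≤r r≤s) (Decreasing-head l)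

ιH-removeBox₁ : ∀ s ρ → All (0 <_) ρ → All (_≤ s) ρ → ι (H (removeBox (suc s ∷ ρ) 1)) ≡ hooks₁ s ρ * ι (H ρ)
ιH-removeBox₁ zero [] p b = refl
ιH-removeBox₁ zero (r ∷ ρ) (0<r ∷ _) (r≤0 ∷ _) = ⊥-elim (NP.<⇒≱ 0<r r≤0)
ιH-removeBox₁ (suc s) ρ p b = trans (cong (λ l → ι (H (suc s ∷ l))) (LP.filter-all pos? p)) (ιH-∷ (suc s) ρ b)

hooks₁-corner : ∀ a ρ ν c k → 1 ≤ c → c ≤ a → conj ρ c ≡ k → conj ρ c ≡ suc (conj ν c) →
  (∀ j → 1 ≤ j → j ≢ c → conj ν j ≡ conj ρ j) →
  hooks₁ a ρ * (ι (a ∸ c) + ι k) ≡ hooks₁ a ν * (ι (a ∸ c) + ι k + 1ℚ)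
hooks₁-corner a ρ ν c k 1≤c c≤a ek es hne = begin
  Π a F * (ι (a ∸ c) + ι k) ≡⟨ cong (_* (ι (a ∸ c) + ι k)) (Π≡f*Π∖ a c F 1≤c c≤a) ⟩
  F c * Π∖ a c F * (ι (a ∸ c) + ι k) ≡⟨ cong₂ (λ u v → u * v * (ι (a ∸ c) + ι k)) eF (Π∖-cong′ a c (λ j h1 _ ne → cong (λ t → ι (suc ((a ∸ j) ℕ.+ t))) (sym (hne j h1 ne)))) ⟩
  (ι (a ∸ c) + ι k + 1ℚ) * Π∖ a c G * (ι (a ∸ c) + ι k)
    ≡⟨ solve 3 (λ u P v → u :* P :* v := v :* P :* u) refl (ι (a ∸ c) + ι k + 1ℚ) (Π∖ a c G) (ι (a ∸ c) + ι k) ⟩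
  (ι (a ∸ c) + ι k) * Π∖ a c G * (ι (a ∸ c) + ι k + 1ℚ) ≡⟨ cong (λ u → u * Π∖ a c G * (ι (a ∸ c) + ι k + 1ℚ)) (sym eG) ⟩
  G c * Π∖ a c G * (ι (a ∸ c) + ι k + 1ℚ) ≡⟨ cong (_* (ι (a ∸ c) + ι k + 1ℚ)) (sym (Π≡f*Π∖ a c G 1≤c c≤a)) ⟩
  Π a G * (ι (a ∸ c) + ι k + 1ℚ) ∎
  where
  open ≡-Reasoning
  F = λ j → ι (suc ((a ∸ j) ℕ.+ conj ρ j))
  G = λ j → ι (suc ((a ∸ j) ℕ.+ conj ν j))
  eF : F c ≡ ι (a ∸ c) + ι k + 1ℚ
  eF = trans (ι-suc-+ (a ∸ c) (conj ρ c)) (cong (λ t → ι (a ∸ c) + ι t + 1ℚ) ek)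
  eG : G c ≡ ι (a ∸ c) + ι k
  eG = trans (cong ι (sym (NP.+-suc (a ∸ c) (conj ν c)))) (trans (ι-+ (a ∸ c) (suc (conj ν c)))
         (cong (λ t → ι (a ∸ c) + ι t) (trans (sym es) ek)))

hooks₁-removeBox : ∀ a ρ k → Decreasing (a ∷ ρ) → part ρ (suc (suc k)) < part ρ (suc k) →
  hooks₁ a ρ * (ι (a ∸ part ρ (suc k)) + ι (suc k)) ≡ hooks₁ a (removeBox ρ (suc k)) * (ι (a ∸ part ρ (suc k)) + ι (suc k) + 1ℚ)
hooks₁-removeBox a ρ k l lt = hooks₁-corner a ρ ν c (suc k) 1≤c c≤a ek es hne
  where
  c = part ρ (suc k)
  ν = removeBox ρ (suc k)
  1≤c : 1 ≤ c
  1≤c = NP.≤-trans (s≤s z≤n) lt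
  c≤a : c ≤ a
  c≤a = part-le a ρ (suc k) (Decreasing-head l)
  ek = conj-corner ρ (suc k) (Decreasing-tail l) (s≤s z≤n) lt
  es = trans (conj-decRow-eq ρ (suc k) c refl 1≤c) (cong suc (sym (conj-filter-pos (decRow ρ (suc k)) c 1≤c)))
  hne : ∀ j → 1 ≤ j → j ≢ c → conj ν j ≡ conj ρ j
  hne j h1 ne = trans (conj-filter-pos (decRow ρ (suc k)) j h1) (conj-decRow-ne ρ (suc k) j ne)

ιH-removeBox-∷ : ∀ a ρ k → Decreasing (a ∷ ρ) → 0 < a →
  ι (H (removeBox (a ∷ ρ) (suc (suc k)))) ≡ hooks₁ a (removeBox ρ (suc k)) * ι (H (removeBox ρ (suc k)))
ιH-removeBox-∷ a ρ k l 0<a = trans (cong (ι ∘ H) (LP.filter-accept pos? {a} {decRow ρ (suc k)} 0<a))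
  (ιH-∷ a (removeBox ρ (suc k)) (AllP.filter⁺ pos? (decRow-All≤ a ρ (suc k) (Decreasing-head l))))

HookRatio : List ℕ → ℕ → ℕ → Set
HookRatio la k N =
  ι (H la) * Π∖ N k (λ i → shifted la i - shifted la k) ≡ ι (H (removeBox la k)) * (ι N + shifted la k) * Π∖ N k (λ i → 1ℚ + shifted la i - shifted la k)

hook-ratio-row₁ : ∀ s ρ L → Decreasing (suc s ∷ ρ) → All (0 <_) ρ → part ρ 1 < suc s → length ρ ≤ L →
  HookRatio (suc s ∷ ρ) 1 (suc L)
hook-ratio-row₁ s ρ L l p lt le = begin
  ι (H la) * Π L (λ i → shifted la (suc i) - shifted la 1) ≡⟨ cong₂ _*_ (ιH-∷ (suc s) ρ (Decreasing-head l)) eXL ⟩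
  hooks₁ (suc s) ρ * ι (H ρ) * Πgaps⁺ s ρ L ≡⟨ solve 3 (λ R h x → R :* h :* x := h :* (R :* x)) refl (hooks₁ (suc s) ρ) (ι (H ρ)) (Πgaps⁺ s ρ L) ⟩
  ι (H ρ) * (hooks₁ (suc s) ρ * Πgaps⁺ s ρ L) ≡⟨ cong (ι (H ρ) *_) (hooks₁-suc s ρ L (Decreasing-tail l) p bρ le) ⟩
  ι (H ρ) * (hooks₁ s ρ * (ι (suc L) + ι s) * Πgaps s ρ L)
    ≡⟨ solve 4 (λ h R u y → h :* (R :* u :* y) := R :* h :* u :* y) refl (ι (H ρ)) (hooks₁ s ρ) (ι (suc L) + ι s) (Πgaps s ρ L) ⟩
  hooks₁ s ρ * ι (H ρ) * (ι (suc L) + ι s) * Πgaps s ρ L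
    ≡⟨ cong₂ (λ u v → u * v * Πgaps s ρ L) (sym (ιH-removeBox₁ s ρ p bρ)) (cong (ι (suc L) +_) (sym eA1)) ⟩
  ι (H (removeBox la 1)) * (ι (suc L) + shifted la 1) * Πgaps s ρ L ≡⟨ cong (ι (H (removeBox la 1)) * (ι (suc L) + shifted la 1) *_) (sym eYL) ⟩
  ι (H (removeBox la 1)) * (ι (suc L) + shifted la 1) * Π L (λ i → 1ℚ + shifted la (suc i) - shifted la 1) ∎
  where
  open ≡-Reasoning
  la = suc s ∷ ρ
  bρ = Decreasing⇒All≤ s ρ (Decreasing-tail l) (NP.≤-pred lt)
  eA1 : shifted la 1 ≡ ι s
  eA1 = trans (cong (_- 1ℚ) (ι-suc s)) (solve 1 (λ S → S :+ con 1ℚ :- con 1ℚ := S) refl (ι s))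
  eXL : Π L (λ i → shifted la (suc i) - shifted la 1) ≡ Πgaps⁺ s ρ L
  eXL = Π-cong L (λ { (suc i) _ _ → trans (cong₂ (λ u v → ι (part ρ (suc i)) - u - (v - 1ℚ)) (ι-suc (suc i)) (ι-suc s))
          (solve 3 (λ P I S → P :- (I :+ con 1ℚ) :- (S :+ con 1ℚ :- con 1ℚ) := P :- I :- con 1ℚ :- S) refl (ι (part ρ (suc i))) (ι (suc i)) (ι s)) })
  eYL : Π L (λ i → 1ℚ + shifted la (suc i) - shifted la 1) ≡ Πgaps s ρ L
  eYL = Π-cong L (λ { (suc i) _ _ → trans (cong₂ (λ u v → 1ℚ + (ι (part ρ (suc i)) - u) - (v - 1ℚ)) (ι-suc (suc i)) (ι-suc s))
          (solve 3 (λ P I S → con 1ℚ :+ (P :- (I :+ con 1ℚ)) :- (S :+ con 1ℚ :- con 1ℚ) := P :- I :- S) refl (ι (part ρ (suc i))) (ι (suc i)) (ι s)) })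

hook-ratio-∷ : ∀ a ρ k L → Decreasing (a ∷ ρ) → 0 < a → part ρ (suc (suc k)) < part ρ (suc k) →
  HookRatio ρ (suc k) L → HookRatio (a ∷ ρ) (suc (suc k)) (suc L)
hook-ratio-∷ a ρ k L l 0<a lt IH = begin
  ι (H la) * (f 1 * Π∖ L (suc k) (λ i → f (suc i)))
    ≡⟨ cong₂ (λ u v → u * (v * Π∖ L (suc k) (λ i → f (suc i)))) (ιH-∷ a ρ (Decreasing-head l)) ef1 ⟩
  hooks₁ a ρ * ι (H ρ) * ((ι (a ∸ c) + ι (suc k)) * Π∖ L (suc k) (λ i → f (suc i))) ≡⟨ cong (λ u → hooks₁ a ρ * ι (H ρ) * ((ι (a ∸ c) + ι (suc k)) * u)) eT ⟩
  hooks₁ a ρ * ι (H ρ) * ((ι (a ∸ c) + ι (suc k)) * Tρ)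
    ≡⟨ solve 4 (λ R h u T → R :* h :* (u :* T) := R :* u :* (h :* T)) refl (hooks₁ a ρ) (ι (H ρ)) (ι (a ∸ c) + ι (suc k)) Tρ ⟩
  hooks₁ a ρ * (ι (a ∸ c) + ι (suc k)) * (ι (H ρ) * Tρ) ≡⟨ cong₂ _*_ RC IH ⟩
  hooks₁ a ν * (ι (a ∸ c) + ι (suc k) + 1ℚ) * (ι (H ν) * (ι L + shifted ρ (suc k)) * Tρ')
    ≡⟨ solve 5 (λ R u h w T → R :* u :* (h :* w :* T) := R :* h :* w :* (u :* T)) refl (hooks₁ a ν) (ι (a ∸ c) + ι (suc k) + 1ℚ) (ι (H ν)) (ι L + shifted ρ (suc k)) Tρ' ⟩
  hooks₁ a ν * ι (H ν) * (ι L + shifted ρ (suc k)) * ((ι (a ∸ c) + ι (suc k) + 1ℚ) * Tρ')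
    ≡⟨ cong₂ (λ u v → u * v * ((ι (a ∸ c) + ι (suc k) + 1ℚ) * Tρ')) (sym (ιH-removeBox-∷ a ρ k l 0<a)) (sym eN) ⟩
  ι (H (removeBox la (suc (suc k)))) * (ι (suc L) + shifted la (suc (suc k))) * ((ι (a ∸ c) + ι (suc k) + 1ℚ) * Tρ')
    ≡⟨ cong₂ (λ u v → ι (H (removeBox la (suc (suc k)))) * (ι (suc L) + shifted la (suc (suc k))) * (u * v)) (sym eg1) (sym eT') ⟩
  ι (H (removeBox la (suc (suc k)))) * (ι (suc L) + shifted la (suc (suc k))) * (gg 1 * Π∖ L (suc k) (λ i → gg (suc i))) ∎
  where
  open ≡-Reasoning
  la = a ∷ ρ
  f = λ i → shifted la i - shifted la (suc (suc k))
  gg = λ i → 1ℚ + shifted la i - shifted la (suc (suc k))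
  c = part ρ (suc k)
  ν = removeBox ρ (suc k)
  c≤a : c ≤ a
  c≤a = part-le a ρ (suc k) (Decreasing-head l)
  Tρ = Π∖ L (suc k) (λ i → shifted ρ i - shifted ρ (suc k))
  Tρ' = Π∖ L (suc k) (λ i → 1ℚ + shifted ρ i - shifted ρ (suc k))
  RC = hooks₁-removeBox a ρ k l lt
  ιac : ι (a ∸ c) ≡ ι a - ι c
  ιac = ι-∸ a c c≤a
  ef1 : f 1 ≡ ι (a ∸ c) + ι (suc k)
  ef1 = trans (cong (λ v → ι a - 1ℚ - (ι c - v)) (ι-suc (suc k)))
          (trans (solve 3 (λ x y z → x :- con 1ℚ :- (y :- (z :+ con 1ℚ)) := x :- y :+ z) refl (ι a) (ι c) (ι (suc k)))
            (cong (_+ ι (suc k)) (sym ιac)))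
  eg1 : gg 1 ≡ ι (a ∸ c) + ι (suc k) + 1ℚ
  eg1 = trans (cong (λ v → 1ℚ + (ι a - 1ℚ) - (ι c - v)) (ι-suc (suc k)))
          (trans (solve 3 (λ x y z → con 1ℚ :+ (x :- con 1ℚ) :- (y :- (z :+ con 1ℚ)) := x :- y :+ z :+ con 1ℚ) refl (ι a) (ι c) (ι (suc k)))
            (cong (λ u → u + ι (suc k) + 1ℚ) (sym ιac)))
  eT : Π∖ L (suc k) (λ i → f (suc i)) ≡ Tρ
  eT = Π∖-cong L (suc k) (λ { (suc i) _ _ → trans (cong₂ (λ u v → ι (part ρ (suc i)) - u - (ι c - v)) (ι-suc (suc i)) (ι-suc (suc k)))
         (solve 4 (λ P I C K → P :- (I :+ con 1ℚ) :- (C :- (K :+ con 1ℚ)) := P :- I :- (C :- K)) refl (ι (part ρ (suc i))) (ι (suc i)) (ι c) (ι (suc k))) })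
  eT' : Π∖ L (suc k) (λ i → gg (suc i)) ≡ Tρ'
  eT' = Π∖-cong L (suc k) (λ { (suc i) _ _ → trans (cong₂ (λ u v → 1ℚ + (ι (part ρ (suc i)) - u) - (ι c - v)) (ι-suc (suc i)) (ι-suc (suc k)))
         (solve 4 (λ P I C K → con 1ℚ :+ (P :- (I :+ con 1ℚ)) :- (C :- (K :+ con 1ℚ)) := con 1ℚ :+ (P :- I) :- (C :- K)) refl (ι (part ρ (suc i))) (ι (suc i)) (ι c) (ι (suc k))) })
  eN : ι (suc L) + shifted la (suc (suc k)) ≡ ι L + shifted ρ (suc k)
  eN = trans (cong₂ (λ u v → u + (ι c - v)) (ι-suc L) (ι-suc (suc k)))
         (solve 3 (λ Lq C K → Lq :+ con 1ℚ :+ (C :- (K :+ con 1ℚ)) := Lq :+ (C :- K)) refl (ι L) (ι c) (ι (suc k)))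

-- Peeling off the first row: its hooks change only in the column of the removed box (hooks₁-corner),
-- while the rows below are handled by induction.
hook-ratio : ∀ la k N → Decreasing la → All (0 <_) la → 1 ≤ k → part la (suc k) < part la k → length la ≤ N →
  HookRatio la k N
hook-ratio [] k N l p _ () le
hook-ratio (zero ∷ ρ) k N l (() ∷ p) h1 lt le
hook-ratio (suc s ∷ ρ) (suc zero) (suc L) l (_ ∷ p) _ lt (s≤s le) = hook-ratio-row₁ s ρ L l p lt le
hook-ratio (a ∷ ρ) (suc (suc k)) (suc L) l (0<a ∷ p) _ lt (s≤s le) =
  hook-ratio-∷ a ρ k L l 0<a lt (hook-ratio ρ (suc k) L (Decreasing-tail l) p (s≤s z≤n) lt le)

removeBox-∷ : ∀ a ρ k → 0 < a → removeBox (a ∷ ρ) (suc (suc k)) ≡ a ∷ removeBox ρ (suc k)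
removeBox-∷ a ρ k 0<a = LP.filter-accept pos? {a} {decRow ρ (suc k)} 0<a

removeBox₁ : ∀ s ρ → All (0 <_) ρ → removeBox (suc (suc s) ∷ ρ) 1 ≡ suc s ∷ ρ
removeBox₁ s ρ p = cong (suc s ∷_) (LP.filter-all pos? p)

corner-empty : ∀ ρ → All (0 <_) ρ → part ρ 1 < 1 → ρ ≡ []
corner-empty [] _ _ = refl
corner-empty (r ∷ ρ) (p ∷ _) (s≤s lt) = ⊥-elim (NP.<⇒≱ p lt)

part-removeBox-≡ : ∀ la k → All (0 <_) la → 1 ≤ k → part la (suc k) < part la k → part (removeBox la k) k ≡ part la k ∸ 1
part-removeBox-≡ [] k p h () 
part-removeBox-≡ (zero ∷ ρ) k (() ∷ p) h cor
part-removeBox-≡ (suc zero ∷ ρ) (suc zero) (_ ∷ p) h cor rewrite corner-empty ρ p cor = refl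
part-removeBox-≡ (suc (suc s) ∷ ρ) (suc zero) (_ ∷ p) h cor = cong (λ l → part l 1) (removeBox₁ s ρ p)
part-removeBox-≡ (suc a ∷ ρ) (suc (suc k)) (_ ∷ p) h cor = trans (cong (λ l → part l (suc (suc k))) (removeBox-∷ (suc a) ρ k (s≤s z≤n)))
  (part-removeBox-≡ ρ (suc k) p (s≤s z≤n) cor)

part-removeBox-≢ : ∀ la k i → All (0 <_) la → 1 ≤ k → part la (suc k) < part la k → i ≢ k → part (removeBox la k) i ≡ part la i
part-removeBox-≢ [] k i p h () ne
part-removeBox-≢ (zero ∷ ρ) k i (() ∷ p) h cor ne
part-removeBox-≢ (suc zero ∷ ρ) (suc zero) i (_ ∷ p) h cor ne rewrite corner-empty ρ p cor = helper i ne
  where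
  helper : ∀ i → i ≢ 1 → part [] i ≡ part (1 ∷ []) i
  helper zero _ = refl
  helper (suc zero) ne = ⊥-elim (ne refl)
  helper (suc (suc i)) _ = refl
part-removeBox-≢ (suc (suc s) ∷ ρ) (suc zero) i (_ ∷ p) h cor ne = trans (cong (λ l → part l i) (removeBox₁ s ρ p)) (helper i ne)
  where
  helper : ∀ i → i ≢ 1 → part (suc s ∷ ρ) i ≡ part (suc (suc s) ∷ ρ) i
  helper zero _ = refl
  helper (suc zero) ne = ⊥-elim (ne refl)
  helper (suc (suc i)) _ = refl
part-removeBox-≢ (suc a ∷ ρ) (suc (suc k)) i (_ ∷ p) h cor ne = trans (cong (λ l → part l i) (removeBox-∷ (suc a) ρ k (s≤s z≤n))) (helper i ne)
  where
  helper : ∀ i → i ≢ suc (suc k) → part (suc a ∷ removeBox ρ (suc k)) i ≡ part (suc a ∷ ρ) i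
  helper zero _ = refl
  helper (suc zero) _ = refl
  helper (suc (suc i)) ne = part-removeBox-≢ ρ (suc k) (suc i) p (s≤s z≤n) cor (λ e → ne (cong suc e))

size-removeBox : ∀ la k → All (0 <_) la → 1 ≤ k → part la (suc k) < part la k → suc (size (removeBox la k)) ≡ size la
size-removeBox [] k p h ()
size-removeBox (zero ∷ ρ) k (() ∷ p) h cor
size-removeBox (suc zero ∷ ρ) (suc zero) (_ ∷ p) h cor rewrite corner-empty ρ p cor = refl
size-removeBox (suc (suc s) ∷ ρ) (suc zero) (_ ∷ p) h cor = cong (λ l → suc (size l)) (removeBox₁ s ρ p)
size-removeBox (suc a ∷ ρ) (suc (suc k)) (_ ∷ p) h cor = trans (cong (λ l → suc (size l)) (removeBox-∷ (suc a) ρ k (s≤s z≤n)))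
  (trans (sym (NP.+-suc (suc a) (size (removeBox ρ (suc k))))) (cong (suc a ℕ.+_) (size-removeBox ρ (suc k) p (s≤s z≤n) cor)))

shifted-removeBox : ∀ la k i → All (0 <_) la → 1 ≤ k → part la (suc k) < part la k → shifted (removeBox la k) i ≡ shifted la i - δ k i
shifted-removeBox la k i p h cor = helper (i ℕ.≟ k)
  where
  eqK : shifted (removeBox la k) k ≡ shifted la k - δ k k
  eqK = trans (cong (λ t → ι t - ι k) (part-removeBox-≡ la k p h cor))
      (trans (cong (_- ι k) (ι-∸ (part la k) 1 (NP.≤-trans (s≤s z≤n) cor)))
        (trans (solve 2 (λ P I → P :- con 1ℚ :- I := P :- I :- con 1ℚ) refl (ι (part la k)) (ι k))
          (cong (λ t → shifted la k - t) (sym (δ-refl k)))))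
  helper : Dec (i ≡ k) → shifted (removeBox la k) i ≡ shifted la i - δ k i
  helper (yes e) = subst (λ i → shifted (removeBox la k) i ≡ shifted la i - δ k i) (sym e) eqK
  helper (no ne) = trans (cong (λ t → ι t - ι i) (part-removeBox-≢ la k i p h cor ne))
      (trans (solve 1 (λ x → x := x :- con 0ℚ) refl (shifted la i)) (cong (λ t → shifted la i - t) (sym (δ-ne k i ne))))

-- The expansion of g_λ(x + 1) − g_λ(x)

Corner : List ℕ → ℕ → Set
Corner la k = part la (suc k) < part la k

corner? : (la : List ℕ) (k : ℕ) → Dec (Corner la k)
corner? la k = part la (suc k) <? part la k

weight′ : ∀ la k → Dec (Corner la k) → ℚ
weight′ la k (yes _) = ι (H la) * invℕ (H (removeBox la k))
weight′ la k (no _) = 0ℚ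

weight : List ℕ → ℕ → ℚ
weight la k = weight′ la k (corner? la k)

term′ : ∀ la (x : ℚ) k → Dec (Corner la k) → ℚ
term′ la x k (yes _) = g (removeBox la k) x * invℕ (H (removeBox la k))
term′ la x k (no _) = 0ℚ

term : List ℕ → ℚ → ℕ → ℚ
term la x k = term′ la x k (corner? la k)

weight′-corner : ∀ la k d → Corner la k → weight′ la k d ≡ ι (H la) * invℕ (H (removeBox la k))
weight′-corner la k (yes _) c = refl
weight′-corner la k (no nc) c = ⊥-elim (nc c)

weight′-noncorner : ∀ la k d → ¬ Corner la k → weight′ la k d ≡ 0ℚ
weight′-noncorner la k (yes c) nc = ⊥-elim (nc c)
weight′-noncorner la k (no _) nc = refl

term′-corner : ∀ la x k d → Corner la k → term′ la x k d ≡ g (removeBox la k) x * invℕ (H (removeBox la k))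
term′-corner la x k (yes _) c = refl
term′-corner la x k (no nc) c = ⊥-elim (nc c)

term′-noncorner : ∀ la x k d → ¬ Corner la k → term′ la x k d ≡ 0ℚ
term′-noncorner la x k (yes c) nc = ⊥-elim (nc c)
term′-noncorner la x k (no _) nc = refl

noncorner-factor : ∀ la N k → Decreasing la → 1 ≤ k → k < N → ¬ Corner la k → Π N (λ i → 1ℚ + shifted la i - shifted la k) ≡ 0ℚ
noncorner-factor la N k l h1 k<N nc = Π≡0 N (suc k) (λ i → 1ℚ + shifted la i - shifted la k) (s≤s z≤n) k<N
  (trans (cong₂ (λ u v → 1ℚ + (ι u - v) - shifted la k) peq (ι-suc k))
    (solve 2 (λ P K → con 1ℚ :+ (P :- (K :+ con 1ℚ)) :- (P :- K) := con 0ℚ) refl (ι (part la k)) (ι k)))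
  where
  peq : part la (suc k) ≡ part la k
  peq = NP.≤-antisym (part-mono la k (suc k) l h1 (NP.n≤1+n k)) (NP.≮⇒≥ nc)

module Partition (la : List ℕ) (m : ℕ) (l : Decreasing la) (p : All (0 <_) la) (e : size la ≡ suc m) where
  N : ℕ
  N = suc m
  a : ℕ → ℚ
  a = shifted la
  lenN : length la ≤ N
  lenN = subst (length la ≤_) e (len≤size la p)

  weight-ratio : ∀ k → 1 ≤ k → Corner la k → weight la k * Π∖ N k (λ i → a i - a k) ≡ (ι N + a k) * Π∖ N k (λ i → 1ℚ + a i - a k)
  weight-ratio k h1 c = begin
    weight la k * Π∖ N k f ≡⟨ cong (_* Π∖ N k f) (weight′-corner la k (corner? la k) c) ⟩
    ι (H la) * inv * Π∖ N k f ≡⟨ solve 3 (λ x y z → x :* y :* z := y :* (x :* z)) refl (ι (H la)) inv (Π∖ N k f) ⟩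
    inv * (ι (H la) * Π∖ N k f) ≡⟨ cong (inv *_) (hook-ratio la k N l p h1 c lenN) ⟩
    inv * (ι (H μ) * (ι N + a k) * Π∖ N k gg)
      ≡⟨ solve 4 (λ y h u v → y :* (h :* u :* v) := (h :* y) :* u :* v) refl inv (ι (H μ)) (ι N + a k) (Π∖ N k gg) ⟩
    ι (H μ) * inv * (ι N + a k) * Π∖ N k gg ≡⟨ cong (λ t → t * (ι N + a k) * Π∖ N k gg) (ιH*invℕH μ) ⟩
    1ℚ * (ι N + a k) * Π∖ N k gg ≡⟨ cong (_* Π∖ N k gg) (QP.*-identityˡ (ι N + a k)) ⟩
    (ι N + a k) * Π∖ N k gg ∎
    where
    open ≡-Reasoning
    μ = removeBox la k
    inv = invℕ (H μ)
    f = λ i → a i - a k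
    gg = λ i → 1ℚ + a i - a k

  -- If row N were nonempty, all N rows would have one box each and λ would have no corner k < N.
  part-N≡0 : ∀ k → 1 ≤ k → k < N → Corner la k → part la N ≡ 0
  part-N≡0 k h1 k<N c = helper (length la <? N)
    where
    helper : Dec (length la < N) → part la N ≡ 0
    helper (yes lt) = part-zero la N lt
    helper (no nlt) = ⊥-elim (NP.<⇒≱ (part-pos la (suc k) p (s≤s z≤n) (NP.≤-trans k<N (NP.≮⇒≥ nlt))) (NP.≤-pred (NP.≤-trans c pk≤1)))
      where
      lenEq : length la ≡ size la
      lenEq = NP.≤-antisym (len≤size la p) (subst (_≤ length la) (sym e) (NP.≮⇒≥ nlt))
      pk≤1 : part la k ≤ 1
      pk≤1 = part-le 1 la k (length≡size⇒All≤1 la p lenEq)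

  weight-residue : ∀ k → 1 ≤ k → k ≤ N → weight la k * Π∖ N k (λ i → a i - a k) ≡ (ι N + a k) * Π N (λ i → 1ℚ + a i - a k)
  weight-residue k h1 h2 = helper (corner? la k)
    where
    helper : Dec (Corner la k) → weight la k * Π∖ N k (λ i → a i - a k) ≡ (ι N + a k) * Π N (λ i → 1ℚ + a i - a k)
    helper (yes c) = trans (weight-ratio k h1 c) (cong ((ι N + a k) *_) (sym (trans (Π≡f*Π∖ N k (λ i → 1ℚ + a i - a k) h1 h2)
      (trans (cong (_* Π∖ N k (λ i → 1ℚ + a i - a k)) (solve 1 (λ x → con 1ℚ :+ x :- x := con 1ℚ) refl (a k))) (QP.*-identityˡ (Π∖ N k (λ i → 1ℚ + a i - a k)))))))
    helper (no nc) = trans (cong (_* Π∖ N k (λ i → a i - a k)) (weight′-noncorner la k (corner? la k) nc))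
      (trans (QP.*-zeroˡ (Π∖ N k (λ i → a i - a k))) (sym (residue≡0 (NP.m≤n⇒m<n∨m≡n h2))))
      where
      residue≡0 : k < N ⊎ k ≡ N → (ι N + a k) * Π N (λ i → 1ℚ + a i - a k) ≡ 0ℚ
      residue≡0 (inj₁ k<N) = trans (cong ((ι N + a k) *_) (noncorner-factor la N k l h1 k<N nc)) (QP.*-zeroʳ (ι N + a k))
      residue≡0 (inj₂ refl) = trans (cong (_* Π N (λ i → 1ℚ + a i - a k)) z0) (QP.*-zeroˡ (Π N (λ i → 1ℚ + a i - a k)))
        where
        pN : part la N ≡ 0
        pN = NP.n≤0⇒n≡0 (subst (part la N ≤_) (part-zero la (suc N) (s≤s lenN)) (NP.≮⇒≥ nc))
        z0 : ι N + a N ≡ 0ℚ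
        z0 = trans (cong (λ t → ι N + (ι t - ι N)) pN) (solve 1 (λ n → n :+ (con 0ℚ :- n) := con 0ℚ) refl (ι N))

  Σweight≡N : Σ N (weight la) ≡ ι N
  Σweight≡N = begin
    Σ N (weight la) ≡⟨ ResidueSum.Σc≡ m a (weight la) (shifted-distinct la N l) weight-residue ⟩
    ι N * ι N + Σ N a - binom₂ N ≡⟨ cong (λ t → ι N * ι N + t - binom₂ N) (trans (Σ-sub N (λ i → ι (part la i)) ι) (cong (_- Σ N ι) (trans (Σpart≡size la N lenN) (cong ι e)))) ⟩
    ι N * ι N + (ι N - Σ N ι) - binom₂ N ≡⟨ cong (λ t → t + (ι N - Σ N ι) - binom₂ N) (sym (Σι+binom₂≡square N)) ⟩
    Σ N ι + binom₂ N + (ι N - Σ N ι) - binom₂ N ≡⟨ solve 3 (λ S C n → S :+ C :+ (n :- S) :- C := n) refl (Σ N ι) (binom₂ N) (ι N) ⟩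
    ι N ∎
    where open ≡-Reasoning

  N+a≢0 : ∀ k → k ≤ m → ι N + a k ≢ 0ℚ
  N+a≢0 k k≤m eu = ι-suc≢0 (m ∸ k ℕ.+ part la k) (trans (trans (ι-suc-+ (m ∸ k) (part la k))
    (trans (cong (λ t → t + ι (part la k) + 1ℚ) (ι-∸ m k k≤m))
      (trans (solve 3 (λ M K P → M :- K :+ P :+ con 1ℚ := M :+ con 1ℚ :+ (P :- K)) refl (ι m) (ι k) (ι (part la k)))
        (cong (_+ a k) (sym (ι-suc m)))))) eu)

  -- Row N is empty below a corner k ≤ m, so the N-th factors of weight-ratio are explicit;
  -- cancelling N + a k leaves the node condition.
  weight-node-corner : ∀ k → 1 ≤ k → k ≤ m → Corner la k →
    Π N (λ i → 1ℚ + a i - a k) ≡ weight la k * (-1ℚ * Π∖ m k (λ i → a i - a k))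
  weight-node-corner k h1 h2 c = begin
    Π N gg ≡⟨ Π≡f*Π∖ N k gg h1 (NP.m≤n⇒m≤1+n h2) ⟩
    gg k * Π∖ N k gg ≡⟨ cong₂ _*_ (solve 1 (λ x → con 1ℚ :+ x :- x := con 1ℚ) refl (a k)) (Π∖-last m k gg h1 h2) ⟩
    1ℚ * (Y' * gg N) ≡⟨ QP.*-identityˡ _ ⟩
    Y' * gg N ≡⟨ cong (λ t → Y' * (1ℚ + t - a k)) aN ⟩
    Y' * (1ℚ + (0ℚ - ι N) - a k) ≡⟨ sym cancelled ⟩
    -1ℚ * (weight la k * X') ≡⟨ solve 3 (λ u c x → con -1ℚ :* (c :* x) := c :* (con -1ℚ :* x)) refl (ι N) (weight la k) X' ⟩
    weight la k * (-1ℚ * X') ∎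
    where
    open ≡-Reasoning
    f = λ i → a i - a k
    gg = λ i → 1ℚ + a i - a k
    X' = Π∖ m k f
    Y' = Π∖ m k gg
    aN : a N ≡ 0ℚ - ι N
    aN = cong (λ t → ι t - ι N) (part-N≡0 k h1 (s≤s h2) c)
    u = ι N + a k
    ratio : weight la k * (X' * (0ℚ - ι N - a k)) ≡ u * (Y' * (1ℚ + (0ℚ - ι N) - a k))
    ratio = begin
      weight la k * (X' * (0ℚ - ι N - a k)) ≡⟨ cong (λ t → weight la k * (X' * (t - a k))) (sym aN) ⟩
      weight la k * (X' * f N) ≡⟨ cong (weight la k *_) (sym (Π∖-last m k f h1 h2)) ⟩
      weight la k * Π∖ N k f ≡⟨ weight-ratio k h1 c ⟩
      u * Π∖ N k gg ≡⟨ cong (u *_) (Π∖-last m k gg h1 h2) ⟩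
      u * (Y' * gg N) ≡⟨ cong (λ t → u * (Y' * (1ℚ + t - a k))) aN ⟩
      u * (Y' * (1ℚ + (0ℚ - ι N) - a k)) ∎
    cancelled : -1ℚ * (weight la k * X') ≡ Y' * (1ℚ + (0ℚ - ι N) - a k)
    cancelled = *-cancelˡ-≡ u (N+a≢0 k h2) (trans (solve 4 (λ n ak c x → (n :+ ak) :* (con -1ℚ :* (c :* x)) := c :* (x :* (con 0ℚ :- n :- ak))) refl (ι N) (a k) (weight la k) X') ratio)

  weight-node : ∀ k → 1 ≤ k → k ≤ m → Π N (λ i → 1ℚ + a i - a k) ≡ weight la k * (-1ℚ * Π∖ m k (λ i → a i - a k))
  weight-node k h1 h2 = case corner? la k of λ where
    (yes c) → weight-node-corner k h1 h2 c
    (no nc) → trans (noncorner-factor la N k l h1 (s≤s h2) nc)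
      (sym (trans (cong (_* (-1ℚ * Π∖ m k (λ i → a i - a k))) (weight′-noncorner la k (corner? la k) nc))
        (QP.*-zeroˡ (-1ℚ * Π∖ m k (λ i → a i - a k)))))

  ℓ : ℕ
  ℓ = length la

  weight-term : ∀ x k → 1 ≤ k → k ≤ N → weight la k * Π m (λ i → x + (a i - δ k i)) * invℕ (H la) ≡ term la x k
  weight-term x k h1 h2 = helper (corner? la k)
    where
    G = Π m (λ i → x + (a i - δ k i))
    helper : Dec (Corner la k) → weight la k * G * invℕ (H la) ≡ term la x k
    helper (no nc) = trans (cong (λ t → t * G * invℕ (H la)) (weight′-noncorner la k (corner? la k) nc))
      (trans (solve 2 (λ y z → con 0ℚ :* y :* z := con 0ℚ) refl G (invℕ (H la))) (sym (term′-noncorner la x k (corner? la k) nc)))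
    helper (yes c) = begin
      weight la k * G * invℕ (H la) ≡⟨ cong (λ t → t * G * invℕ (H la)) (weight′-corner la k (corner? la k) c) ⟩
      ι (H la) * invℕ (H μ) * G * invℕ (H la)
        ≡⟨ solve 4 (λ h i g j → h :* i :* g :* j := g :* i :* (h :* j)) refl (ι (H la)) (invℕ (H μ)) G (invℕ (H la)) ⟩
      G * invℕ (H μ) * (ι (H la) * invℕ (H la)) ≡⟨ cong (G * invℕ (H μ) *_) (ιH*invℕH la) ⟩
      G * invℕ (H μ) * 1ℚ ≡⟨ QP.*-identityʳ _ ⟩
      G * invℕ (H μ) ≡⟨ cong (_* invℕ (H μ)) (sym gμ) ⟩
      g μ x * invℕ (H μ) ≡⟨ sym (term′-corner la x k (corner? la k) c) ⟩
      term la x k ∎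
      where
      open ≡-Reasoning
      μ = removeBox la k
      sμ : size μ ≡ m
      sμ = NP.suc-injective (trans (size-removeBox la k p h1 c) e)
      gμ : g μ x ≡ G
      gμ = trans (g≡Π μ x) (trans (cong (λ t → Π t (λ i → x + shifted μ i)) sμ)
             (Π-cong m (λ i _ _ → cong (x +_) (shifted-removeBox la k i p h1 c))))

  Σterm-beyond-length : ∀ x → Σ (N ∸ ℓ) (λ i → term la x (ℓ ℕ.+ i)) ≡ 0ℚ
  Σterm-beyond-length x = Σ≡0 (N ∸ ℓ) _ (λ i h1 _ → term′-noncorner la x (ℓ ℕ.+ i) (corner? la (ℓ ℕ.+ i))
     (λ lt → NP.n≮0 (subst (part la (suc (ℓ ℕ.+ i)) <_) (part-zero la (ℓ ℕ.+ i) (NP.m<m+n ℓ h1)) lt)))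

  Σcorners≡Σterm : ∀ x → sumℚ (map (λ μ → g μ x * invℕ (H μ)) (removeCorner la)) ≡ Σ N (term la x)
  Σcorners≡Σterm x = begin
    sumℚ (map F (map (removeBox la) (corners la))) ≡⟨ cong sumℚ (sym (LP.map-∘ (corners la))) ⟩
    sumℚ (map (F ∘ removeBox la) (corners la))
      ≡⟨ sumℚ-filter (corner? la) (F ∘ removeBox la) (term la x) (range1 ℓ)
           (λ k c → term′-corner la x k (corner? la k) c) (λ k nc → term′-noncorner la x k (corner? la k) nc) ⟩
    sumℚ (map (term la x) (range1 ℓ)) ≡⟨ sumℚ-range1 ℓ (term la x) ⟩
    Σ ℓ (term la x) ≡⟨ sym (QP.+-identityʳ _) ⟩
    Σ ℓ (term la x) + 0ℚ ≡⟨ cong (Σ ℓ (term la x) +_) (sym (Σterm-beyond-length x)) ⟩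
    Σ ℓ (term la x) + Σ (N ∸ ℓ) (λ i → term la x (ℓ ℕ.+ i)) ≡⟨ sym (Σ-split ℓ (N ∸ ℓ) (term la x)) ⟩
    Σ (ℓ ℕ.+ (N ∸ ℓ)) (term la x) ≡⟨ cong (λ t → Σ t (term la x)) (NP.m+[n∸m]≡n lenN) ⟩
    Σ N (term la x) ∎
    where
    open ≡-Reasoning
    F = λ μ → g μ x * invℕ (H μ)

  g-shift≡Π : ∀ x → g la (x + 1ℚ) ≡ Π N (λ i → x + (1ℚ + a i))
  g-shift≡Π x = trans (g≡Π la (x + 1ℚ)) (trans (cong (λ t → Π t (λ i → x + 1ℚ + a i)) e)
    (Π-cong N (λ i _ _ → QP.+-assoc x 1ℚ (a i))))

  g≡Π-N : ∀ x → g la x ≡ Π N (λ i → x + a i)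
  g≡Π-N x = trans (g≡Π la x) (cong (λ t → Π t (λ i → x + a i)) e)

theorem1p1 : (n : ℕ) → 1 ≤ n → (la : List ℕ) → IsPartition la → size la ≡ n →
    (x : ℚ) →
    (g la (x + 1ℚ) - g la x) * invℕ (H la)
    ≡ sumℚ (map (λ μ → g μ x * invℕ (H μ)) (removeCorner la))
theorem1p1 zero () la lp e x
theorem1p1 (suc m) _ la (l , p) e x = begin
  (g la (x + 1ℚ) - g la x) * invℕ (H la)                        ≡⟨ cong₂ (λ u v → (u - v) * invℕ (H la)) (g-shift≡Π x) (g≡Π-N x) ⟩
  (Π N (λ i → x + (1ℚ + a i)) - Π N (λ i → x + a i)) * invℕ (H la)
    ≡⟨ cong (_* invℕ (H la)) (DifferenceExpansion.Δ≡Σc m a (weight la) (shifted-distinct la N l) Σweight≡N weight-node x) ⟩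
  Σ N G * invℕ (H la)                                             ≡⟨ trans (QP.*-comm (Σ N G) (invℕ (H la))) (sym (Σ-scale N (invℕ (H la)) G)) ⟩
  Σ N (λ k → invℕ (H la) * G k)                                   ≡⟨ Σ-cong N (λ k h1 h2 → trans (QP.*-comm (invℕ (H la)) (G k)) (weight-term x k h1 h2)) ⟩
  Σ N (term la x)                                                 ≡⟨ sym (Σcorners≡Σterm x) ⟩
  sumℚ (map (λ μ → g μ x * invℕ (H μ)) (removeCorner la))        ∎
  where
  open ≡-Reasoning
  open Partition la m l p e
  G : ℕ → ℚ
  G k = weight la k * Π m (λ i → x + (a i - δ k i))
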